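{- Let $\mathcal T$ be the rooted labelled tree whose root (at level $0$) has label $(1)$, and in which every node with label $(s)$ at level $n$ has, for each $j\in\{1,\dots,s\}$: exactly $s+1-j$ children labelled $(j)$ at level $n+1$, exactly $s+1-j$ children labelled $(j+1)$ at level $n+2$, and exactly $\binom{s+1-j}{2}$ children labelled $(j)$ at level $n+2$ (and no other children). Then for every $n\geqslant 0$, the number of nodes of $\mathcal T$ at level $n$ equals $|\mathcal{I}_n(000,102)|$.
   Context: For $n\in\mathbb N$, an inversion sequence of size $n$ is a sequence $\sigma=(\sigma_1,\dots,\sigma_n)\in\mathbb N^n$ with $\sigma_i<i$ for all $i$. An integer sequence contains a pattern $\rho$ (a finite integer sequence such as $000$ or $102$) if it has a subsequence order-isomorphic to $\rho$, and avoids $\rho$ otherwise. $\mathcal{I}_n(P)$ denotes the set of inversion sequences of size $n$ avoiding every pattern in the set $P$. -}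

module Defs where

open import Data.Bool using (Bool)
open import Data.Bool.Properties using () renaming (_≟_ to _≟ᵇ_)
open import Data.Nat using (ℕ; zero; suc; _+_; _*_; _∸_; _<ᵇ_)
open import Data.Nat.Properties using () renaming (_≟_ to _≟ℕ_)
open import Data.Nat.Combinatorics using (_C_)
open import Data.Nat.ListAction using (sum)
open import Data.List using (List; []; _∷_; [_]; _++_; map; concatMap; upTo; length; zip; filter)
open import Data.List.Relation.Unary.All using (All)
open import Data.List.Relation.Unary.All.Properties using ()
import Data.List.Relation.Unary.All as All
open import Data.List.Relation.Unary.Any using (Any)
import Data.List.Relation.Unary.Any as Any
open import Data.Product using (_×_; _,_; proj₁; proj₂)
open import Relation.Binary.PropositionalEquality using (_≡_)
open import Relation.Nullary using (Dec; ¬_)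
open import Relation.Nullary.Decidable using (_×-dec_; ¬?)

-- The generating tree 𝒯.
-- nodes d s = number of nodes at depth d (relative) in the subtree
-- rooted at a node labelled (s).  A node labelled (s) has, for each
-- j ∈ {1..s} (written j = suc i, i ∈ upTo s, so s+1-j = s ∸ i):
--   s+1-j children labelled (j)   one level below,
--   s+1-j children labelled (j+1) two levels below,
--   C(s+1-j,2) children labelled (j) two levels below.

nodes : ℕ → ℕ → ℕ
nodes zero s = 1
nodes (suc zero) s = sum (map (λ i → (s ∸ i) * nodes zero (suc i)) (upTo s))
nodes (suc (suc d)) s =
  sum (map (λ i → (s ∸ i) * nodes (suc d) (suc i)
                + (s ∸ i) * nodes d (suc (suc i))
                + ((s ∸ i) C 2) * nodes d (suc i)) (upTo s))

levelCount : ℕ → ℕ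
levelCount n = nodes n 1

-- all inversion sequences of size n: σ_i ∈ {0,…,i-1} (1-indexed)
invSeqs : ℕ → List (List ℕ)
invSeqs zero = [ [] ]
invSeqs (suc n) = concatMap (λ σ → map (λ a → σ ++ [ a ]) (upTo (suc n))) (invSeqs n)

subseqs : List ℕ → List (List ℕ)
subseqs [] = [ [] ]
subseqs (x ∷ xs) = map (x ∷_) (subseqs xs) ++ subseqs xs

OrderIso : List ℕ → List ℕ → Set
OrderIso τ ρ = length τ ≡ length ρ ×
  All (λ p → All (λ q → (proj₁ p <ᵇ proj₁ q) ≡ (proj₂ p <ᵇ proj₂ q)) (zip τ ρ)) (zip τ ρ)

orderIso? : (τ ρ : List ℕ) → Dec (OrderIso τ ρ)
orderIso? τ ρ = (length τ ≟ℕ length ρ) ×-dec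
  All.all? (λ p → All.all? (λ q → (proj₁ p <ᵇ proj₁ q) ≟ᵇ (proj₂ p <ᵇ proj₂ q)) (zip τ ρ)) (zip τ ρ)

Contains : List ℕ → List ℕ → Set
Contains ρ σ = Any (λ τ → OrderIso τ ρ) (subseqs σ)

contains? : (ρ σ : List ℕ) → Dec (Contains ρ σ)
contains? ρ σ = Any.any? (λ τ → orderIso? τ ρ) (subseqs σ)

Avoids : List (List ℕ) → List ℕ → Set
Avoids P σ = All (λ ρ → ¬ Contains ρ σ) P

avoids? : (P : List (List ℕ)) (σ : List ℕ) → Dec (Avoids P σ)
avoids? P σ = All.all? (λ ρ → ¬? (contains? ρ σ)) P

numAvoiding : List (List ℕ) → ℕ → ℕ
numAvoiding P n = length (filter (avoids? P) (invSeqs n))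

{-# OPTIONS --safe #-}

-- Call a sequence good if it avoids 102 and each positive value occurs at most twice
-- (zeros are unrestricted).  Prepending 0 to σ + 1 identifies 𝓘ₙ(000,102) with the good
-- inversion sequences of size n + 1 having a single 0.  Let G d s count the good inversion
-- sequences with d positive entries and s zeros, G⁺ d s those not ending in 0, and G¹ d s
-- those with exactly one 1.  Deleting a final 0 gives G d (s+1) = G d s + G⁺ d (s+1).  A good
-- sequence not ending in 0 either has a 1 before a 0, and then it ends in 0 1 (deleting
-- these leaves a sequence with one 1), or all its k ≤ 2 ones follow all its zeros (deleting
-- the leading 0 and decrementing turns the ones into zeros).  Hence
--   G⁺ (d+2) (s+1) = G¹ (d+1) s + G⁺ (d+2) s + G (d+1) (s+1) + G d (s+2),
-- and G¹ (d+1) s = Σ_{i<s} G d (i+1) by the same deletions.  The branching rule of the tree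
-- gives nodes d the same second-difference recurrence in s, so induction on d yields
-- G d s = nodes d s; the theorem is the case s = 1.

module Submission where

open import Defs
open import Data.Bool using (Bool; true; false; _∧_; _∨_; not; T; if_then_else_)
open import Data.Bool.ListAction using (any)
open import Data.Bool.Properties
  using (T-≡; ∧-assoc; ∧-comm; ∧-identityʳ; ∧-zeroʳ; ∨-assoc; ∨-zeroʳ; ∨-identityʳ)
open import Data.Empty using (⊥; ⊥-elim)
open import Data.List using (List; []; _∷_; [_]; _++_; map; drop; upTo; length; filterᵇ; _∷ʳ_; _∷ʳ′_; initLast)
open import Data.List.Properties
  using (++-assoc; ++-cancelʳ; ∷ʳ-injective; upTo-∷ʳ; map-++; map-∘; map-id; length-++; length-map; length-filter;
         length-removeAt′; filter-++; filter-none; filter-some; filter-≐)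
open import Data.List.Membership.Propositional using (_∈_; find; lose)
open import Data.List.Membership.Propositional.Properties
  using (∈-map⁺; ∈-map⁻; ∈-concatMap⁺; ∈-concatMap⁻; ∈-upTo⁺; ∈-upTo⁻; ∈-filter⁺; ∈-filter⁻)
open import Data.List.Relation.Unary.All as All using (All; []; _∷_)
import Data.List.Relation.Unary.All.Properties as All
open import Data.List.Relation.Unary.AllPairs as AllPairs using ([]; _∷_)
import Data.List.Relation.Unary.AllPairs.Properties as AllPairs
open import Data.List.Relation.Unary.Any as Any using (Any; here; there; _─_)
import Data.List.Relation.Unary.Any.Properties as Any
open import Data.List.Relation.Unary.Any.Properties using (any⁺; any⁻)
open import Data.List.Relation.Unary.Unique.Propositional using (Unique)
import Data.List.Relation.Unary.Unique.Propositional.Properties as Unique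
open import Data.Nat using (ℕ; zero; suc; pred; _∸_; _⊓_; _+_; _*_; _≤_; _<_; z≤n; s≤s; s≤s⁻¹; _≡ᵇ_; _<ᵇ_; _≤ᵇ_)
open import Data.Nat.Combinatorics using (_C_; nCk+nC[k+1]≡[n+1]C[k+1]; nC1≡n)
open import Data.Nat.ListAction using (sum)
open import Data.Nat.ListAction.Properties using (sum-++)
open import Data.Nat.Properties
open import Algebra.Properties.CommutativeSemigroup +-commutativeSemigroup
  using (interchange; xy∙z≈y∙xz; x∙yz≈y∙zx)
open import Data.Nat.Tactic.RingSolver using (solve-∀)
open import Data.Product as Product using (_×_; _,_; proj₁; proj₂; ∃-syntax)
open import Data.Sum using (_⊎_; inj₁; inj₂; [_,_]′)
open import Function using (_∘_; case_of_; Equivalence)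
open import Relation.Binary.PropositionalEquality hiding ([_])
open import Relation.Nullary using (¬_; yes; no)
open import Relation.Nullary.Decidable using (T?)

private variable
  A B : Set
  Q : List ℕ → Set

∧-true⁻ : ∀ {a b} → a ∧ b ≡ true → a ≡ true × b ≡ true
∧-true⁻ {true} {true} _ = refl , refl

∧-true⁺ : ∀ {a b} → a ≡ true → b ≡ true → a ∧ b ≡ true
∧-true⁺ refl refl = refl

∨-false⁻ : ∀ {a b} → a ∨ b ≡ false → a ≡ false × b ≡ false
∨-false⁻ {false} {false} _ = refl , refl

not-true⁻ : ∀ {a} → not a ≡ true → a ≡ false
not-true⁻ {false} _ = refl

not-true⁺ : ∀ {a} → a ≡ false → not a ≡ true
not-true⁺ refl = refl

∨-true⇒ˡ : ∀ {a b} → a ∨ b ≡ true → b ≡ false → a ≡ true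
∨-true⇒ˡ {true}  _ _    = refl
∨-true⇒ˡ {false} h refl = h

true-or-false : ∀ b → b ≡ true ⊎ b ≡ false
true-or-false true  = inj₁ refl
true-or-false false = inj₂ refl

true≢false : true ≢ false
true≢false ()

T⇒≡true : ∀ {a} → T a → a ≡ true
T⇒≡true = Equivalence.to T-≡

≡true⇒T : ∀ {a} → a ≡ true → T a
≡true⇒T = Equivalence.from T-≡

≡ᵇ-true⁻ : ∀ {m n} → (m ≡ᵇ n) ≡ true → m ≡ n
≡ᵇ-true⁻ {m} {n} e = ≡ᵇ⇒≡ m n (≡true⇒T e)

≡ᵇ-true⁺ : ∀ {m n} → m ≡ n → (m ≡ᵇ n) ≡ true
≡ᵇ-true⁺ {m} {n} e = T⇒≡true (≡⇒≡ᵇ m n e)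

≡ᵇ-false⁺ : ∀ {m n} → m ≢ n → (m ≡ᵇ n) ≡ false
≡ᵇ-false⁺ {m} {n} m≢n with m ≡ᵇ n in e
... | false = refl
... | true  = ⊥-elim (m≢n (≡ᵇ-true⁻ e))

≤ᵇ-true⁻ : ∀ {m n} → (m ≤ᵇ n) ≡ true → m ≤ n
≤ᵇ-true⁻ {m} {n} e = ≤ᵇ⇒≤ m n (≡true⇒T e)

≤ᵇ-true⁺ : ∀ {m n} → m ≤ n → (m ≤ᵇ n) ≡ true
≤ᵇ-true⁺ le = T⇒≡true (≤⇒≤ᵇ le)

≤ᵇ-false⁻ : ∀ {m n} → (m ≤ᵇ n) ≡ false → n < m
≤ᵇ-false⁻ e = ≰⇒> (λ m≤n → true≢false (trans (sym (≤ᵇ-true⁺ m≤n)) e))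

<ᵇ-true⁻ : ∀ {m n} → (m <ᵇ n) ≡ true → m < n
<ᵇ-true⁻ {m} {n} e = <ᵇ⇒< m n (≡true⇒T e)

<ᵇ-true⁺ : ∀ {m n} → m < n → (m <ᵇ n) ≡ true
<ᵇ-true⁺ lt = T⇒≡true (<⇒<ᵇ lt)

<ᵇ-false⁻ : ∀ {m n} → (m <ᵇ n) ≡ false → n ≤ m
<ᵇ-false⁻ {m} {n} e = ≮⇒≥ (λ m<n → subst T e (<⇒<ᵇ m<n))

<ᵇ-false⁺ : ∀ {m n} → n ≤ m → (m <ᵇ n) ≡ false
<ᵇ-false⁺ {m} {n} n≤m with m <ᵇ n in e
... | false = refl
... | true  = ⊥-elim (<⇒≱ (<ᵇ-true⁻ e) n≤m)

<ᵇ-irrefl : ∀ x → (x <ᵇ x) ≡ false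
<ᵇ-irrefl x = <ᵇ-false⁺ (≤-refl {x})

any-++ : (p : ℕ → Bool) (xs ys : List ℕ) → any p (xs ++ ys) ≡ any p xs ∨ any p ys
any-++ p []       ys = refl
any-++ p (x ∷ xs) ys = trans (cong (p x ∨_) (any-++ p xs ys)) (sym (∨-assoc (p x) _ _))

count : (A → Bool) → List A → ℕ
count p xs = length (filterᵇ p xs)

count-++ : (p : A → Bool) (xs ys : List A) → count p (xs ++ ys) ≡ count p xs + count p ys
count-++ p xs ys = trans (cong length (filter-++ (T? ∘ p) xs ys)) (length-++ (filterᵇ p xs))

count-cong : (p q : A → Bool) (xs : List A) → (∀ {x} → x ∈ xs → p x ≡ q x) → count p xs ≡ count q xs
count-cong p q [] _ = refl
count-cong p q (x ∷ xs) p≗q with p x | q x | p≗q (here refl)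
... | true  | true  | _ = cong suc (count-cong p q xs (p≗q ∘ there))
... | false | false | _ = count-cong p q xs (p≗q ∘ there)

count-none : (p : A → Bool) (xs : List A) → (∀ {x} → x ∈ xs → p x ≡ false) → count p xs ≡ 0
count-none p xs none = cong length (filter-none (T? ∘ p) (All.tabulate (λ x∈xs → subst T (none x∈xs))))

count-split : (p c : A → Bool) (xs : List A) →
  count p xs ≡ count (λ x → p x ∧ c x) xs + count (λ x → p x ∧ not (c x)) xs
count-split p c [] = refl
count-split p c (x ∷ xs) with p x | c x
... | true  | true  = cong suc (count-split p c xs)
... | true  | false = trans (cong suc (count-split p c xs)) (sym (+-suc _ _))
... | false | _     = count-split p c xs

count-split-≤2 : (p : A → Bool) (v : A → ℕ) (xs : List A) → (∀ {x} → x ∈ xs → p x ≡ true → v x ≤ 2) →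
  count p xs ≡ count (λ x → p x ∧ (v x ≡ᵇ 0)) xs
             + (count (λ x → p x ∧ (v x ≡ᵇ 1)) xs + count (λ x → p x ∧ (v x ≡ᵇ 2)) xs)
count-split-≤2 p v [] _ = refl
count-split-≤2 p v (x ∷ xs) v≤2 with p x in px
... | false = count-split-≤2 p v xs (v≤2 ∘ there)
... | true with v x | v≤2 (here refl) px | count-split-≤2 p v xs (v≤2 ∘ there)
...   | 0 | _ | ih = cong suc ih
...   | 1 | _ | ih = trans (cong suc ih) (sym (+-suc _ _))
...   | 2 | _ | ih = trans (cong suc ih) (sym (trans (cong (c₀ +_) (+-suc c₁ c₂)) (+-suc c₀ (c₁ + c₂))))
  where
  c₀ = count (λ x → p x ∧ (v x ≡ᵇ 0)) xs
  c₁ = count (λ x → p x ∧ (v x ≡ᵇ 1)) xs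
  c₂ = count (λ x → p x ∧ (v x ≡ᵇ 2)) xs
...   | suc (suc (suc _)) | s≤s (s≤s ()) | _

∈-filterᵇ⁻ : (p : A → Bool) {x : A} {xs : List A} → x ∈ filterᵇ p xs → x ∈ xs × p x ≡ true
∈-filterᵇ⁻ p x∈ with x∈xs , px ← ∈-filter⁻ (T? ∘ p) x∈ = x∈xs , T⇒≡true px

∈-filterᵇ⁺ : (p : A → Bool) {x : A} {xs : List A} → x ∈ xs → p x ≡ true → x ∈ filterᵇ p xs
∈-filterᵇ⁺ p x∈xs px = ∈-filter⁺ (T? ∘ p) x∈xs (≡true⇒T px)

∈-─ : {y b : A} {ys : List A} (y∈ys : y ∈ ys) → b ∈ ys → b ≢ y → b ∈ (ys ─ y∈ys)
∈-─ (here refl) (here refl) b≢y = ⊥-elim (b≢y refl)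
∈-─ (here refl) (there b∈) _    = b∈
∈-─ (there _)   (here refl) _   = here refl
∈-─ (there y∈)  (there b∈) b≢y  = there (∈-─ y∈ b∈ b≢y)

length-≤-injection : {xs : List A} {ys : List B} (f : A → B) → Unique xs →
  (∀ {a} → a ∈ xs → f a ∈ ys) → (∀ {a a′} → a ∈ xs → a′ ∈ xs → f a ≡ f a′ → a ≡ a′) →
  length xs ≤ length ys
length-≤-injection {xs = []} f _ _ _ = z≤n
length-≤-injection {xs = a ∷ xs} {ys} f (a∉xs ∷ uxs) into inj =
  subst (suc (length xs) ≤_) (sym (length-removeAt′ ys _))
    (s≤s (length-≤-injection f uxs into′ (λ m m′ → inj (there m) (there m′))))
  where
  into′ : ∀ {a′} → a′ ∈ xs → f a′ ∈ (ys ─ into (here refl))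
  into′ a′∈xs = ∈-─ (into (here refl)) (into (there a′∈xs))
    (λ fa′≡fa → All.lookup a∉xs a′∈xs (sym (inj (there a′∈xs) (here refl) fa′≡fa)))

length-≡-bijection : {xs : List A} {ys : List B} → Unique xs → Unique ys → (f : A → B) (g : B → A) →
  (∀ {a} → a ∈ xs → f a ∈ ys × g (f a) ≡ a) → (∀ {b} → b ∈ ys → g b ∈ xs × f (g b) ≡ b) →
  length xs ≡ length ys
length-≡-bijection uxs uys f g f∈ g∈ = ≤-antisym
  (length-≤-injection f uxs (proj₁ ∘ f∈) (λ m m′ e → trans (sym (proj₂ (f∈ m))) (trans (cong g e) (proj₂ (f∈ m′)))))
  (length-≤-injection g uys (proj₁ ∘ g∈) (λ m m′ e → trans (sym (proj₂ (g∈ m))) (trans (cong f e) (proj₂ (g∈ m′)))))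

-- Inversion sequences

invᵇ : ℕ → List ℕ → Bool
invᵇ k []       = true
invᵇ k (x ∷ xs) = (x ≤ᵇ k) ∧ invᵇ (suc k) xs

InvSeq : ℕ → List ℕ → Set
InvSeq n ρ = length ρ ≡ n × invᵇ 0 ρ ≡ true

invᵇ-++ : ∀ k xs ys → invᵇ k (xs ++ ys) ≡ invᵇ k xs ∧ invᵇ (k + length xs) ys
invᵇ-++ k []       ys rewrite +-identityʳ k = refl
invᵇ-++ k (x ∷ xs) ys rewrite invᵇ-++ (suc k) xs ys | +-suc k (length xs) = sym (∧-assoc (x ≤ᵇ k) _ _)

InvSeq-++⁺ : ∀ {n σ} τ → InvSeq n σ → invᵇ n τ ≡ true → InvSeq (length τ + n) (σ ++ τ)
InvSeq-++⁺ {n} {σ} τ (refl , inv) τ-ok =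
  trans (length-++ σ) (+-comm n (length τ)) , trans (invᵇ-++ 0 σ τ) (∧-true⁺ inv τ-ok)

InvSeq-++⁻ : ∀ {n σ} τ → InvSeq (length τ + n) (σ ++ τ) → InvSeq n σ × invᵇ n τ ≡ true
InvSeq-++⁻ {n} {σ} τ (len , inv) = (len-σ , proj₁ inv-σ,τ) , subst (λ k → invᵇ k τ ≡ true) len-σ (proj₂ inv-σ,τ)
  where
  len-σ : length σ ≡ n
  len-σ = +-cancelʳ-≡ (length τ) (length σ) n (trans (sym (length-++ σ)) (trans len (+-comm (length τ) n)))
  inv-σ,τ = ∧-true⁻ (trans (sym (invᵇ-++ 0 σ τ)) inv)

∈-invSeqs⁻ : ∀ n {ρ} → ρ ∈ invSeqs n → InvSeq n ρ
∈-invSeqs⁻ zero (here refl) = refl , refl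
∈-invSeqs⁻ (suc n) ρ∈
  with σ , σ∈ , ρ∈σ∷ʳ ← find (∈-concatMap⁻ (λ σ → map (σ ∷ʳ_) (upTo (suc n))) {xs = invSeqs n} ρ∈)
  with a , a∈ , refl ← ∈-map⁻ (σ ∷ʳ_) ρ∈σ∷ʳ =
  InvSeq-++⁺ {n} {σ} [ a ] (∈-invSeqs⁻ n σ∈) (∧-true⁺ (≤ᵇ-true⁺ (s≤s⁻¹ (∈-upTo⁻ a∈))) refl)

∈-invSeqs⁺ : ∀ n {ρ} → InvSeq n ρ → ρ ∈ invSeqs n
∈-invSeqs⁺ zero    {[]} _ = here refl
∈-invSeqs⁺ (suc n) {ρ}  _ with initLast ρ
∈-invSeqs⁺ (suc n) {.(σ ∷ʳ a)} isInv | σ ∷ʳ′ a with σ-inv , a-ok ← InvSeq-++⁻ {n} {σ} [ a ] isInv =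
  ∈-concatMap⁺ (λ σ → map (σ ∷ʳ_) (upTo (suc n)))
    (lose (∈-invSeqs⁺ n σ-inv) (∈-map⁺ (σ ∷ʳ_) (∈-upTo⁺ (s≤s (≤ᵇ-true⁻ (proj₁ (∧-true⁻ a-ok)))))))

invSeqs-unique : ∀ n → Unique (invSeqs n)
invSeqs-unique zero    = [] ∷ []
invSeqs-unique (suc n) = Unique.concat⁺ extensions-unique (AllPairs.map⁺ (AllPairs.map disjoint (invSeqs-unique n)))
  where
  extensions : List ℕ → List (List ℕ)
  extensions σ = map (σ ∷ʳ_) (upTo (suc n))
  extensions-unique : All Unique (map extensions (invSeqs n))
  extensions-unique = All.map⁺ (All.tabulate (λ {σ} _ → Unique.map⁺ (proj₂ ∘ ∷ʳ-injective σ σ) (Unique.upTo⁺ (suc n))))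
  disjoint : ∀ {σ τ} → σ ≢ τ → ∀ {ρ} → ¬ (ρ ∈ extensions σ × ρ ∈ extensions τ)
  disjoint {σ} {τ} σ≢τ (ρ∈σ , ρ∈τ)
    with _ , _ , refl ← ∈-map⁻ (σ ∷ʳ_) ρ∈σ | _ , _ , e ← ∈-map⁻ (τ ∷ʳ_) ρ∈τ =
    σ≢τ (proj₁ (∷ʳ-injective σ τ e))

Embeds : ℕ → (List ℕ → Bool) → ℕ → (List ℕ → Bool) → (f g : List ℕ → List ℕ) → Set
Embeds m q n p f g = ∀ {κ} → InvSeq m κ → q κ ≡ true → InvSeq n (f κ) × p (f κ) ≡ true × g (f κ) ≡ κ

count-invSeqs-bijection : ∀ {m n p q} (f g : List ℕ → List ℕ) → Embeds m q n p f g → Embeds n p m q g f →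
  count p (invSeqs n) ≡ count q (invSeqs m)
count-invSeqs-bijection {m} {n} {p} {q} f g f-emb g-emb =
  length-≡-bijection (Unique.filter⁺ (T? ∘ p) (invSeqs-unique n)) (Unique.filter⁺ (T? ∘ q) (invSeqs-unique m)) g f
    (transport g f g-emb) (transport f g f-emb)
  where
  transport : ∀ {m n p q} f g → Embeds m q n p f g →
    ∀ {κ} → κ ∈ filterᵇ q (invSeqs m) → f κ ∈ filterᵇ p (invSeqs n) × g (f κ) ≡ κ
  transport {m} {n} {p} {q} f g emb κ∈
    with κ∈m , qκ ← ∈-filterᵇ⁻ q κ∈
    with fκ-inv , pfκ , gfκ ← emb (∈-invSeqs⁻ m κ∈m) qκ = ∈-filterᵇ⁺ p (∈-invSeqs⁺ n fκ-inv) pfκ , gfκ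

count-suffix : ∀ {n} τ (p q : List ℕ → Bool) (unappend : List ℕ → List ℕ) → invᵇ n τ ≡ true →
  (∀ σ → unappend (σ ++ τ) ≡ σ) → (∀ {ρ} → p ρ ≡ true → ρ ≡ unappend ρ ++ τ) →
  (∀ σ → q σ ≡ true → p (σ ++ τ) ≡ true) → (∀ σ → p (σ ++ τ) ≡ true → q σ ≡ true) →
  count p (invSeqs (length τ + n)) ≡ count q (invSeqs n)
count-suffix {n} τ p q unappend τ-ok unappend-++ shape q⇒p p⇒q = count-invSeqs-bijection (_++ τ) unappend append-emb unappend-emb
  where
  append-emb : Embeds n q (length τ + n) p (_++ τ) unappend
  append-emb {σ} σ-inv qσ = InvSeq-++⁺ {n} {σ} τ σ-inv τ-ok , q⇒p σ qσ , unappend-++ σ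
  unappend-emb : Embeds (length τ + n) p n q unappend (_++ τ)
  unappend-emb {ρ} ρ-inv pρ with σ ← unappend ρ | refl ← shape pρ =
    proj₁ (InvSeq-++⁻ {n} {σ} τ ρ-inv) , p⇒q σ pρ , refl

-- Avoiding 000 and 102

SomePair : (ℕ → ℕ → Set) → List ℕ → Set
SomePair R []       = ⊥
SomePair R (y ∷ ys) = Any (R y) ys ⊎ SomePair R ys

SomeTriple : (ℕ → ℕ → ℕ → Set) → List ℕ → Set
SomeTriple R []       = ⊥
SomeTriple R (x ∷ xs) = SomePair (R x) xs ⊎ SomeTriple R xs

SomePair-map : ∀ {R S} → (∀ {y z} → R y z → S y z) → ∀ xs → SomePair R xs → SomePair S xs
SomePair-map R⇒S (y ∷ ys) (inj₁ r) = inj₁ (Any.map R⇒S r)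
SomePair-map R⇒S (y ∷ ys) (inj₂ r) = inj₂ (SomePair-map R⇒S ys r)

SomeTriple-map : ∀ {R S} → (∀ {x y z} → R x y z → S x y z) → ∀ xs → SomeTriple R xs → SomeTriple S xs
SomeTriple-map R⇒S (x ∷ xs) (inj₁ r) = inj₁ (SomePair-map R⇒S xs r)
SomeTriple-map R⇒S (x ∷ xs) (inj₂ r) = inj₂ (SomeTriple-map R⇒S xs r)

Any-subseqs-∷⁻ : ∀ x xs → Any Q (subseqs (x ∷ xs)) → Any (Q ∘ (x ∷_)) (subseqs xs) ⊎ Any Q (subseqs xs)
Any-subseqs-∷⁻ x xs q with Any.++⁻ (map (x ∷_) (subseqs xs)) q
... | inj₁ q′ = inj₁ (Any.map⁻ q′)
... | inj₂ q′ = inj₂ q′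

Any-subseqs-∷⁺ : ∀ x xs → Any (Q ∘ (x ∷_)) (subseqs xs) ⊎ Any Q (subseqs xs) → Any Q (subseqs (x ∷ xs))
Any-subseqs-∷⁺ x xs (inj₁ q) = Any.++⁺ˡ (Any.map⁺ q)
Any-subseqs-∷⁺ x xs (inj₂ q) = Any.++⁺ʳ (map (x ∷_) (subseqs xs)) q

[]∈subseqs : ∀ xs → [] ∈ subseqs xs
[]∈subseqs []       = here refl
[]∈subseqs (x ∷ xs) = Any.++⁺ʳ (map (x ∷_) (subseqs xs)) ([]∈subseqs xs)

Any-subseqs-singleton⁻ : ∀ xs → (∀ {τ} → Q τ → length τ ≡ 1) → Any Q (subseqs xs) → Any (Q ∘ [_]) xs
Any-subseqs-singleton⁻ [] len (here q) with () ← len q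
Any-subseqs-singleton⁻ (x ∷ xs) len q with Any-subseqs-∷⁻ x xs q
... | inj₂ q′ = there (Any-subseqs-singleton⁻ xs len q′)
... | inj₁ q′ with find q′
...   | [] , _ , qx = here qx
...   | _ ∷ _ , _ , qx∷y∷τ with () ← len qx∷y∷τ

Any-subseqs-singleton⁺ : ∀ xs → Any (Q ∘ [_]) xs → Any Q (subseqs xs)
Any-subseqs-singleton⁺ (x ∷ xs) (here q)  = Any-subseqs-∷⁺ x xs (inj₁ (lose ([]∈subseqs xs) q))
Any-subseqs-singleton⁺ (x ∷ xs) (there q) = Any-subseqs-∷⁺ x xs (inj₂ (Any-subseqs-singleton⁺ xs q))

Any-subseqs-pair⁻ : ∀ xs → (∀ {τ} → Q τ → length τ ≡ 2) → Any Q (subseqs xs) →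
  SomePair (λ y z → Q (y ∷ z ∷ [])) xs
Any-subseqs-pair⁻ [] len (here q) with () ← len q
Any-subseqs-pair⁻ (x ∷ xs) len q with Any-subseqs-∷⁻ x xs q
... | inj₁ q′ = inj₁ (Any-subseqs-singleton⁻ xs (suc-injective ∘ len) q′)
... | inj₂ q′ = inj₂ (Any-subseqs-pair⁻ xs len q′)

Any-subseqs-pair⁺ : ∀ xs → SomePair (λ y z → Q (y ∷ z ∷ [])) xs → Any Q (subseqs xs)
Any-subseqs-pair⁺ (x ∷ xs) (inj₁ q) = Any-subseqs-∷⁺ x xs (inj₁ (Any-subseqs-singleton⁺ xs q))
Any-subseqs-pair⁺ (x ∷ xs) (inj₂ q) = Any-subseqs-∷⁺ x xs (inj₂ (Any-subseqs-pair⁺ xs q))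

Any-subseqs-triple⁻ : ∀ xs → (∀ {τ} → Q τ → length τ ≡ 3) → Any Q (subseqs xs) →
  SomeTriple (λ x y z → Q (x ∷ y ∷ z ∷ [])) xs
Any-subseqs-triple⁻ [] len (here q) with () ← len q
Any-subseqs-triple⁻ (x ∷ xs) len q with Any-subseqs-∷⁻ x xs q
... | inj₁ q′ = inj₁ (Any-subseqs-pair⁻ xs (suc-injective ∘ len) q′)
... | inj₂ q′ = inj₂ (Any-subseqs-triple⁻ xs len q′)

Any-subseqs-triple⁺ : ∀ xs → SomeTriple (λ x y z → Q (x ∷ y ∷ z ∷ [])) xs → Any Q (subseqs xs)
Any-subseqs-triple⁺ (x ∷ xs) (inj₁ q) = Any-subseqs-∷⁺ x xs (inj₁ (Any-subseqs-pair⁺ xs q))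
Any-subseqs-triple⁺ (x ∷ xs) (inj₂ q) = Any-subseqs-∷⁺ x xs (inj₂ (Any-subseqs-triple⁺ xs q))

Contains-triple⁻ : ∀ ρ σ → length ρ ≡ 3 → Contains ρ σ → SomeTriple (λ x y z → OrderIso (x ∷ y ∷ z ∷ []) ρ) σ
Contains-triple⁻ ρ σ len = Any-subseqs-triple⁻ σ (λ iso → trans (proj₁ iso) len)

Contains-triple⁺ : ∀ ρ σ → SomeTriple (λ x y z → OrderIso (x ∷ y ∷ z ∷ []) ρ) σ → Contains ρ σ
Contains-triple⁺ ρ σ = Any-subseqs-triple⁺ σ

Pattern000 Pattern102 : ℕ → ℕ → ℕ → Set
Pattern000     x y z = x ≡ y × x ≡ z
Pattern102 x y z = y < x × x < z

OrderIso-000⁻ : ∀ {x y z} → OrderIso (x ∷ y ∷ z ∷ []) (0 ∷ 0 ∷ 0 ∷ []) → Pattern000 x y z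
OrderIso-000⁻ (_ , (_ ∷ x≮y ∷ x≮z ∷ []) ∷ (y≮x ∷ _) ∷ (z≮x ∷ _) ∷ []) =
  ≤-antisym (<ᵇ-false⁻ y≮x) (<ᵇ-false⁻ x≮y) , ≤-antisym (<ᵇ-false⁻ z≮x) (<ᵇ-false⁻ x≮z)

OrderIso-000⁺ : ∀ {x y z} → Pattern000 x y z → OrderIso (x ∷ y ∷ z ∷ []) (0 ∷ 0 ∷ 0 ∷ [])
OrderIso-000⁺ {x} (refl , refl) = refl , row ∷ row ∷ row ∷ []
  where row = <ᵇ-irrefl x ∷ <ᵇ-irrefl x ∷ <ᵇ-irrefl x ∷ []

OrderIso-102⁻ : ∀ {x y z} → OrderIso (x ∷ y ∷ z ∷ []) (1 ∷ 0 ∷ 2 ∷ []) → Pattern102 x y z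
OrderIso-102⁻ (_ , (_ ∷ _ ∷ x<z ∷ []) ∷ (y<x ∷ _) ∷ _ ∷ []) = <ᵇ-true⁻ y<x , <ᵇ-true⁻ x<z

OrderIso-102⁺ : ∀ {x y z} → Pattern102 x y z → OrderIso (x ∷ y ∷ z ∷ []) (1 ∷ 0 ∷ 2 ∷ [])
OrderIso-102⁺ {x} {y} {z} (y<x , x<z) = refl ,
  (<ᵇ-irrefl x ∷ <ᵇ-false⁺ (<⇒≤ y<x) ∷ <ᵇ-true⁺ x<z ∷ []) ∷
  (<ᵇ-true⁺ y<x ∷ <ᵇ-irrefl y ∷ <ᵇ-true⁺ y<z ∷ []) ∷
  (<ᵇ-false⁺ (<⇒≤ x<z) ∷ <ᵇ-false⁺ (<⇒≤ y<z) ∷ <ᵇ-irrefl z ∷ []) ∷ []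
  where y<z = <-trans y<x x<z

occ : ℕ → List ℕ → ℕ
occ x = count (x ≡ᵇ_)

occ-here : ∀ x ys → occ x (x ∷ ys) ≡ suc (occ x ys)
occ-here x ys rewrite ≡ᵇ-true⁺ {x} refl = refl

occ-∷-≤ : ∀ x y ys → occ x ys ≤ occ x (y ∷ ys)
occ-∷-≤ x y ys with x ≡ᵇ y
... | true  = n≤1+n _
... | false = ≤-refl

occ-pos⁺ : ∀ {x ys} → x ∈ ys → 1 ≤ occ x ys
occ-pos⁺ {x} x∈ys = filter-some (T? ∘ (x ≡ᵇ_)) (Any.map (≡⇒≡ᵇ x _) x∈ys)

occ-pos⁻ : ∀ x ys → 1 ≤ occ x ys → x ∈ ys
occ-pos⁻ x (y ∷ ys) pos with x ≡ᵇ y in e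
... | true  = here (≡ᵇ-true⁻ e)
... | false = there (occ-pos⁻ x ys pos)

occ≤length : ∀ x ρ → occ x ρ ≤ length ρ
occ≤length x ρ = length-filter (T? ∘ (x ≡ᵇ_)) ρ

occ0+occ1≤length : ∀ ρ → occ 0 ρ + occ 1 ρ ≤ length ρ
occ0+occ1≤length []                 = z≤n
occ0+occ1≤length (0 ∷ ρ)            = s≤s (occ0+occ1≤length ρ)
occ0+occ1≤length (1 ∷ ρ)            =
  subst (_≤ suc (length ρ)) (sym (+-suc (occ 0 ρ) (occ 1 ρ))) (s≤s (occ0+occ1≤length ρ))
occ0+occ1≤length (suc (suc _) ∷ ρ) = m≤n⇒m≤1+n (occ0+occ1≤length ρ)

heads102ᵇ : ℕ → List ℕ → Bool
heads102ᵇ x []       = false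
heads102ᵇ x (y ∷ ys) = ((y <ᵇ x) ∧ any (x <ᵇ_) ys) ∨ heads102ᵇ x ys

avoidsᵇ : List ℕ → Bool
avoidsᵇ []       = true
avoidsᵇ (x ∷ xs) = (avoidsᵇ xs ∧ (occ x xs ≤ᵇ 1)) ∧ not (heads102ᵇ x xs)

SomePair-000⁻ : ∀ x ys → SomePair (Pattern000 x) ys → 2 ≤ occ x ys
SomePair-000⁻ x (y ∷ ys) (inj₁ r) with z , z∈ys , refl , refl ← find r =
  subst (2 ≤_) (sym (occ-here x ys)) (s≤s (occ-pos⁺ z∈ys))
SomePair-000⁻ x (y ∷ ys) (inj₂ r) = ≤-trans (SomePair-000⁻ x ys r) (occ-∷-≤ x y ys)

SomePair-000⁺ : ∀ x ys → 2 ≤ occ x ys → SomePair (Pattern000 x) ys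
SomePair-000⁺ x (y ∷ ys) twice with x ≡ᵇ y in e
... | true  with refl ← ≡ᵇ-true⁻ {x} {y} e = inj₁ (Any.map (refl ,_) (occ-pos⁻ x ys (s≤s⁻¹ twice)))
... | false = inj₂ (SomePair-000⁺ x ys twice)

SomePair-102⁻ : ∀ x ys → SomePair (Pattern102 x) ys → heads102ᵇ x ys ≡ true
SomePair-102⁻ x (y ∷ ys) (inj₁ r) with z , z∈ys , y<x , x<z ← find r
  rewrite <ᵇ-true⁺ y<x | T⇒≡true (any⁺ (x <ᵇ_) (lose z∈ys (<⇒<ᵇ x<z))) = refl
SomePair-102⁻ x (y ∷ ys) (inj₂ r) = trans (cong (((y <ᵇ x) ∧ any (x <ᵇ_) ys) ∨_) (SomePair-102⁻ x ys r)) (∨-zeroʳ _)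

SomePair-102⁺ : ∀ x ys → heads102ᵇ x ys ≡ true → SomePair (Pattern102 x) ys
SomePair-102⁺ x (y ∷ ys) h with y <ᵇ x in y<x | any (x <ᵇ_) ys in some>x
... | true  | true  = inj₁ (Any.map (λ x<z → <ᵇ-true⁻ y<x , <ᵇ⇒< x _ x<z) (any⁻ (x <ᵇ_) ys (≡true⇒T some>x)))
... | true  | false = inj₂ (SomePair-102⁺ x ys h)
... | false | _     = inj₂ (SomePair-102⁺ x ys h)

avoidsᵇ-sound : ∀ σ → avoidsᵇ σ ≡ true → ¬ SomeTriple Pattern000 σ × ¬ SomeTriple Pattern102 σ
avoidsᵇ-sound [] _ = (λ ()) , (λ ())
avoidsᵇ-sound (x ∷ xs) ok with ok′ , no102 ← ∧-true⁻ ok with ok-xs , occ≤1 ← ∧-true⁻ ok′ =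
  (λ { (inj₁ r) → <⇒≱ (s≤s (≤ᵇ-true⁻ occ≤1)) (SomePair-000⁻ x xs r)
     ; (inj₂ r) → proj₁ (avoidsᵇ-sound xs ok-xs) r }) ,
  (λ { (inj₁ r) → true≢false (trans (sym (SomePair-102⁻ x xs r)) (not-true⁻ no102))
     ; (inj₂ r) → proj₂ (avoidsᵇ-sound xs ok-xs) r })

avoidsᵇ-complete : ∀ σ → ¬ SomeTriple Pattern000 σ → ¬ SomeTriple Pattern102 σ → avoidsᵇ σ ≡ true
avoidsᵇ-complete [] _ _ = refl
avoidsᵇ-complete (x ∷ xs) no000 no102
  rewrite avoidsᵇ-complete xs (no000 ∘ inj₂) (no102 ∘ inj₂)
  with occ x xs ≤ᵇ 1 in occ≤1 | heads102ᵇ x xs in h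
... | true  | false = refl
... | _     | true  = ⊥-elim (no102 (inj₁ (SomePair-102⁺ x xs h)))
... | false | false = ⊥-elim (no000 (inj₁ (SomePair-000⁺ x xs (≤ᵇ-false⁻ occ≤1))))

Avoids-000-102⁻ : ∀ σ → Avoids ((0 ∷ 0 ∷ 0 ∷ []) ∷ (1 ∷ 0 ∷ 2 ∷ []) ∷ []) σ → avoidsᵇ σ ≡ true
Avoids-000-102⁻ σ (no000 ∷ no102 ∷ []) = avoidsᵇ-complete σ
  (no000 ∘ Contains-triple⁺ _ σ ∘ SomeTriple-map OrderIso-000⁺ σ)
  (no102 ∘ Contains-triple⁺ _ σ ∘ SomeTriple-map OrderIso-102⁺ σ)

Avoids-000-102⁺ : ∀ σ → avoidsᵇ σ ≡ true → Avoids ((0 ∷ 0 ∷ 0 ∷ []) ∷ (1 ∷ 0 ∷ 2 ∷ []) ∷ []) σ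
Avoids-000-102⁺ σ ok with no000 , no102 ← avoidsᵇ-sound σ ok =
  (no000 ∘ SomeTriple-map OrderIso-000⁻ σ ∘ Contains-triple⁻ _ σ refl) ∷
  (no102 ∘ SomeTriple-map OrderIso-102⁻ σ ∘ Contains-triple⁻ _ σ refl) ∷ []

numAvoiding-000-102 : ∀ n → numAvoiding ((0 ∷ 0 ∷ 0 ∷ []) ∷ (1 ∷ 0 ∷ 2 ∷ []) ∷ []) n ≡ count avoidsᵇ (invSeqs n)
numAvoiding-000-102 n = cong length (filter-≐ (avoids? _) (T? ∘ avoidsᵇ)
  ((λ {σ} → ≡true⇒T ∘ Avoids-000-102⁻ σ) , (λ {σ} → Avoids-000-102⁺ σ ∘ T⇒≡true)) (invSeqs n))

-- Good sequences

goodᵇ : List ℕ → Bool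
goodᵇ []       = true
goodᵇ (x ∷ xs) = (goodᵇ xs ∧ ((x ≡ᵇ 0) ∨ (occ x xs ≤ᵇ 1))) ∧ not (heads102ᵇ x xs)

goodᵇ-∷⁻ : ∀ x xs → goodᵇ (x ∷ xs) ≡ true →
  goodᵇ xs ≡ true × ((x ≡ᵇ 0) ∨ (occ x xs ≤ᵇ 1)) ≡ true × heads102ᵇ x xs ≡ false
goodᵇ-∷⁻ x xs ok with ok′ , no102 ← ∧-true⁻ ok with ok-xs , few ← ∧-true⁻ ok′ = ok-xs , few , not-true⁻ no102

goodᵇ-occ≤2 : ∀ v ρ → goodᵇ ρ ≡ true → occ (suc v) ρ ≤ 2
goodᵇ-occ≤2 v []       _  = z≤n
goodᵇ-occ≤2 v (y ∷ ys) ok with ok-ys , few , _ ← goodᵇ-∷⁻ y ys ok | suc v ≡ᵇ y in e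
... | false = goodᵇ-occ≤2 v ys ok-ys
... | true with refl ← ≡ᵇ-true⁻ {suc v} {y} e = s≤s (≤ᵇ-true⁻ few)

endsIn0ᵇ : List ℕ → Bool
endsIn0ᵇ []           = false
endsIn0ᵇ (x ∷ [])     = x ≡ᵇ 0
endsIn0ᵇ (_ ∷ y ∷ ys) = endsIn0ᵇ (y ∷ ys)

has10ᵇ : List ℕ → Bool
has10ᵇ []       = false
has10ᵇ (x ∷ xs) = ((x ≡ᵇ 1) ∧ (1 ≤ᵇ occ 0 xs)) ∨ has10ᵇ xs

heads102-0 : ∀ ys → heads102ᵇ 0 ys ≡ false
heads102-0 []       = refl
heads102-0 (_ ∷ ys) = heads102-0 ys

heads102-1 : ∀ ys → occ 0 ys ≡ 0 → heads102ᵇ 1 ys ≡ false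
heads102-1 []           _  = refl
heads102-1 (suc _ ∷ ys) no-0 = heads102-1 ys no-0

[0,1] : List ℕ
[0,1] = 0 ∷ 1 ∷ []

occ0-++01 : ∀ σ → occ 0 (σ ++ [0,1]) ≡ suc (occ 0 σ)
occ0-++01 σ = trans (count-++ (0 ≡ᵇ_) σ [0,1]) (+-comm (occ 0 σ) 1)

occ1-++01 : ∀ σ → occ 1 (σ ++ [0,1]) ≡ suc (occ 1 σ)
occ1-++01 σ = trans (count-++ (1 ≡ᵇ_) σ [0,1]) (+-comm (occ 1 σ) 1)

singleton-1 : ∀ zs → any (1 <ᵇ_) zs ≡ false → occ 0 zs ≡ 0 → occ 1 zs ≤ 1 → 1 ≤ length zs → zs ≡ 1 ∷ []
singleton-1 (1 ∷ [])               _ _ _ _ = refl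
singleton-1 (1 ∷ 1 ∷ _)            _ _ (s≤s ()) _
singleton-1 (1 ∷ suc (suc _) ∷ _) () _ _ _
singleton-1 (suc (suc _) ∷ _)     () _ _ _

tail-ends-with-01 : ∀ ys → has10ᵇ ys ≡ false → 1 ≤ occ 0 ys → heads102ᵇ 1 ys ≡ false → occ 1 ys ≤ 1 →
  endsIn0ᵇ ys ≡ false → ∃[ β ] ys ≡ β ++ [0,1] × occ 1 β ≡ 0
tail-ends-with-01 (0 ∷ [])     _    _ _     _     ()
tail-ends-with-01 (0 ∷ z ∷ zs) no10 _ no102 one-1 end
  with ∨-false⁻ {any (1 <ᵇ_) (z ∷ zs)} no102 | tail-ends-with-01 (z ∷ zs) no10
... | none>1 , no102′ | ih = [ more-zeros , no-more-zeros ]′ (true-or-false (1 ≤ᵇ occ 0 (z ∷ zs)))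
  where
  more-zeros : (1 ≤ᵇ occ 0 (z ∷ zs)) ≡ true → ∃[ β ] 0 ∷ z ∷ zs ≡ β ++ [0,1] × occ 1 β ≡ 0
  more-zeros has0 with β , eq , no-1 ← ih (≤ᵇ-true⁻ has0) no102′ one-1 end = 0 ∷ β , cong (0 ∷_) eq , no-1
  no-more-zeros : (1 ≤ᵇ occ 0 (z ∷ zs)) ≡ false → ∃[ β ] 0 ∷ z ∷ zs ≡ β ++ [0,1] × occ 1 β ≡ 0
  no-more-zeros no0 = [] , cong (0 ∷_) (singleton-1 (z ∷ zs) none>1 (n<1⇒n≡0 (≤ᵇ-false⁻ no0)) one-1 (s≤s z≤n)) , refl
tail-ends-with-01 (1 ∷ ws) no10 has0 _ _ _ rewrite ≤ᵇ-true⁺ has0 with () ← no10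
tail-ends-with-01 (suc (suc y) ∷ z ∷ zs) no10 has0 no102 one-1 end
  with β , eq , no-1 ← tail-ends-with-01 (z ∷ zs) no10 has0 no102 one-1 end =
  suc (suc y) ∷ β , cong (suc (suc y) ∷_) eq , no-1

-- After a 1 that precedes a 0, avoiding 102 leaves only 0s and 1s, and 1 occurs at most twice.
ends-with-01 : ∀ ρ → goodᵇ ρ ≡ true → has10ᵇ ρ ≡ true → endsIn0ᵇ ρ ≡ false →
  ∃[ ν ] ρ ≡ ν ++ [0,1] × occ 1 ν ≡ 1
ends-with-01 (x ∷ []) _ has10 _ rewrite ∧-zeroʳ (x ≡ᵇ 1) with () ← has10
ends-with-01 (0 ∷ y ∷ ys) ok has10 end
  with ν , eq , one-1 ← ends-with-01 (y ∷ ys) (proj₁ (goodᵇ-∷⁻ 0 (y ∷ ys) ok)) has10 end =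
  0 ∷ ν , cong (0 ∷_) eq , one-1
ends-with-01 (suc (suc x) ∷ y ∷ ys) ok has10 end
  with ν , eq , one-1 ← ends-with-01 (y ∷ ys) (proj₁ (goodᵇ-∷⁻ (suc (suc x)) (y ∷ ys) ok)) has10 end =
  suc (suc x) ∷ ν , cong (suc (suc x) ∷_) eq , one-1
ends-with-01 (1 ∷ y ∷ ys) ok has10 end with goodᵇ-∷⁻ 1 (y ∷ ys) ok | ends-with-01 (y ∷ ys)
... | ok′ , at-most-1 , no102 | ih = [ tail-has-10 , tail-has-no-10 ]′ (true-or-false (has10ᵇ (y ∷ ys)))
  where
  tail-has-10 : has10ᵇ (y ∷ ys) ≡ true → ∃[ ν ] 1 ∷ y ∷ ys ≡ ν ++ [0,1] × occ 1 ν ≡ 1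
  tail-has-10 has10′ with ν , eq , one-1 ← ih ok′ has10′ end =
    ⊥-elim (1+n≰n (subst (_≤ 1) (trans (cong (occ 1) eq) (trans (occ1-++01 ν) (cong suc one-1))) (≤ᵇ-true⁻ at-most-1)))
  tail-has-no-10 : has10ᵇ (y ∷ ys) ≡ false → ∃[ ν ] 1 ∷ y ∷ ys ≡ ν ++ [0,1] × occ 1 ν ≡ 1
  tail-has-no-10 no10
    with β , eq , no-1 ←
           tail-ends-with-01 (y ∷ ys) no10 (≤ᵇ-true⁻ (∨-true⇒ˡ has10 no10)) no102 (≤ᵇ-true⁻ at-most-1) end =
    1 ∷ β , cong (1 ∷_) eq , cong suc no-1

one-1⇒no-10 : ∀ ρ → goodᵇ ρ ≡ true → endsIn0ᵇ ρ ≡ false → occ 1 ρ ≡ 1 → has10ᵇ ρ ≡ false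
one-1⇒no-10 ρ ok end one with has10ᵇ ρ in has10
... | false = refl
... | true with ν , refl , one-1 ← ends-with-01 ρ ok has10 end =
  ⊥-elim (1+n≢n (trans (sym (cong suc one-1)) (trans (sym (occ1-++01 ν)) one)))

heads102-++ : ∀ x ys zs → any (x <ᵇ_) zs ≡ false → heads102ᵇ x zs ≡ false →
  heads102ᵇ x (ys ++ zs) ≡ heads102ᵇ x ys
heads102-++ x []       zs _        no102 = no102
heads102-++ x (y ∷ ys) zs none>x no102
  rewrite heads102-++ x ys zs none>x no102 | any-++ (x <ᵇ_) ys zs | none>x | ∨-identityʳ (any (x <ᵇ_) ys) = refl

heads102-∷ʳ0 : ∀ x ys → heads102ᵇ x (ys ∷ʳ 0) ≡ heads102ᵇ x ys
heads102-∷ʳ0 x ys = heads102-++ x ys (0 ∷ []) refl (trans (∨-identityʳ _) (∧-zeroʳ (0 <ᵇ x)))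

occ0-∷ʳ0 : ∀ σ → occ 0 (σ ∷ʳ 0) ≡ suc (occ 0 σ)
occ0-∷ʳ0 σ = trans (count-++ (0 ≡ᵇ_) σ (0 ∷ [])) (+-comm (occ 0 σ) 1)

goodᵇ-∷ʳ0 : ∀ xs → goodᵇ (xs ∷ʳ 0) ≡ goodᵇ xs
goodᵇ-∷ʳ0 []       = refl
goodᵇ-∷ʳ0 (x ∷ xs) rewrite goodᵇ-∷ʳ0 xs | heads102-∷ʳ0 x xs | count-++ (x ≡ᵇ_) xs (0 ∷ []) with x
... | 0     = refl
... | suc n rewrite +-identityʳ (occ (suc n) xs) = refl

endsIn0-∷ʳ : ∀ xs a → endsIn0ᵇ (xs ∷ʳ a) ≡ (a ≡ᵇ 0)
endsIn0-∷ʳ []           a = refl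
endsIn0-∷ʳ (x ∷ [])     a = refl
endsIn0-∷ʳ (x ∷ y ∷ xs) a = endsIn0-∷ʳ (y ∷ xs) a

dropLast : List ℕ → List ℕ
dropLast []           = []
dropLast (x ∷ [])     = []
dropLast (x ∷ y ∷ ys) = x ∷ dropLast (y ∷ ys)

dropLast-∷ʳ : ∀ xs a → dropLast (xs ∷ʳ a) ≡ xs
dropLast-∷ʳ []           a = refl
dropLast-∷ʳ (x ∷ [])     a = refl
dropLast-∷ʳ (x ∷ y ∷ xs) a = cong (x ∷_) (dropLast-∷ʳ (y ∷ xs) a)

endsIn0⇒∷ʳ0 : ∀ ρ → endsIn0ᵇ ρ ≡ true → ρ ≡ dropLast ρ ∷ʳ 0
endsIn0⇒∷ʳ0 (x ∷ [])     end rewrite ≡ᵇ-true⁻ {x} {0} end = refl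
endsIn0⇒∷ʳ0 (x ∷ y ∷ ρ) end = cong (x ∷_) (endsIn0⇒∷ʳ0 (y ∷ ρ) end)

all-zeros-endsIn0 : ∀ {n} ρ → length ρ ≡ suc n → occ 0 ρ ≡ suc n → endsIn0ᵇ ρ ≡ true
all-zeros-endsIn0         (0 ∷ [])    _   _     = refl
all-zeros-endsIn0 {suc n} (0 ∷ y ∷ ρ) len zeros = all-zeros-endsIn0 (y ∷ ρ) (suc-injective len) (suc-injective zeros)
all-zeros-endsIn0         (suc _ ∷ ρ) len zeros =
  ⊥-elim (1+n≰n (subst (_≤ length ρ) (trans zeros (cong suc (sym (suc-injective len)))) (occ≤length 0 ρ)))

heads102-++01 : ∀ x ys → heads102ᵇ x (ys ++ [0,1]) ≡ heads102ᵇ x ys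
heads102-++01 0             ys = trans (heads102-0 (ys ++ [0,1])) (sym (heads102-0 ys))
heads102-++01 1             ys = heads102-++ 1 ys [0,1] refl refl
heads102-++01 (suc (suc x)) ys = heads102-++ (suc (suc x)) ys [0,1] refl refl

goodᵇ-++01 : ∀ xs → occ 1 xs ≤ 1 → goodᵇ (xs ++ [0,1]) ≡ goodᵇ xs
goodᵇ-++01 []       _     = refl
goodᵇ-++01 (x ∷ xs) ones≤1
  rewrite goodᵇ-++01 xs (≤-trans (occ-∷-≤ 1 x xs) ones≤1) | heads102-++01 x xs | count-++ (x ≡ᵇ_) xs [0,1] with x
... | 0             = refl
... | 1             rewrite n≤0⇒n≡0 (s≤s⁻¹ ones≤1) = refl
... | suc (suc x′) rewrite +-identityʳ (occ (suc (suc x′)) xs) = refl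

has10-++0 : ∀ ν ys → 1 ≤ occ 1 ν → has10ᵇ (ν ++ 0 ∷ ys) ≡ true
has10-++0 (0             ∷ ν) ys has1 = has10-++0 ν ys has1
has10-++0 (suc (suc _)   ∷ ν) ys has1 = has10-++0 ν ys has1
has10-++0 (1             ∷ ν) ys _ rewrite count-++ (0 ≡ᵇ_) ν (0 ∷ ys) | +-suc (occ 0 ν) (occ 0 ys) = refl

endsIn0-++01 : ∀ ν → endsIn0ᵇ (ν ++ [0,1]) ≡ false
endsIn0-++01 ν rewrite sym (++-assoc ν (0 ∷ []) (1 ∷ [])) = endsIn0-∷ʳ (ν ∷ʳ 0) 1

dropLast²-++01 : ∀ ν → dropLast (dropLast (ν ++ [0,1])) ≡ ν
dropLast²-++01 ν rewrite sym (++-assoc ν (0 ∷ []) (1 ∷ [])) | dropLast-∷ʳ (ν ∷ʳ 0) 1 = dropLast-∷ʳ ν 0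

-- Increments the positive entries and turns the last k zeros into 1s; this inverts map pred
-- on sequences whose k ones all follow their zeros.
raise : ℕ → List ℕ → List ℕ
raise k []       = []
raise k (x ∷ xs) = raised x ∷ raise k xs
  where
  raised : ℕ → ℕ
  raised 0       = if occ 0 xs <ᵇ k then 1 else 0
  raised (suc x) = suc (suc x)

length-raise : ∀ k xs → length (raise k xs) ≡ length xs
length-raise k []           = refl
length-raise k (0     ∷ xs) = cong suc (length-raise k xs)
length-raise k (suc x ∷ xs) = cong suc (length-raise k xs)

map-pred-raise : ∀ k xs → map pred (raise k xs) ≡ xs
map-pred-raise k []           = refl
map-pred-raise k (suc x ∷ xs) = cong (suc x ∷_) (map-pred-raise k xs)
map-pred-raise k (0     ∷ xs) with occ 0 xs <ᵇ k
... | true  = cong (0 ∷_) (map-pred-raise k xs)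
... | false = cong (0 ∷_) (map-pred-raise k xs)

occ0-raise : ∀ k xs → occ 0 (raise k xs) ≡ occ 0 xs ∸ k
occ0-raise k []           = sym (0∸n≡0 k)
occ0-raise k (suc x ∷ xs) = occ0-raise k xs
occ0-raise k (0     ∷ xs) with occ 0 xs <ᵇ k in lt
... | true  with z<k ← <ᵇ-true⁻ {occ 0 xs} {k} lt =
  trans (occ0-raise k xs) (trans (m≤n⇒m∸n≡0 (<⇒≤ z<k)) (sym (m≤n⇒m∸n≡0 z<k)))
... | false with k≤z ← <ᵇ-false⁻ {occ 0 xs} {k} lt = trans (cong suc (occ0-raise k xs)) (sym (+-∸-assoc 1 k≤z))

occ1-raise : ∀ k xs → occ 1 (raise k xs) ≡ occ 0 xs ⊓ k
occ1-raise k []           = refl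
occ1-raise k (suc x ∷ xs) = occ1-raise k xs
occ1-raise k (0     ∷ xs) with occ 0 xs <ᵇ k in lt
... | true  with z<k ← <ᵇ-true⁻ {occ 0 xs} {k} lt =
  trans (cong suc (occ1-raise k xs)) (trans (cong suc (m≤n⇒m⊓n≡m (<⇒≤ z<k))) (sym (m≤n⇒m⊓n≡m z<k)))
... | false with k≤z ← <ᵇ-false⁻ {occ 0 xs} {k} lt =
  trans (occ1-raise k xs) (trans (m≥n⇒m⊓n≡n k≤z) (sym (m≥n⇒m⊓n≡n (m≤n⇒m≤1+n k≤z))))

occ-raise : ∀ k x xs → occ (suc (suc x)) (raise k xs) ≡ occ (suc x) xs
occ-raise k x []           = refl
occ-raise k x (suc y ∷ xs) with x ≡ᵇ y
... | true  = cong suc (occ-raise k x xs)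
... | false = occ-raise k x xs
occ-raise k x (0     ∷ xs) with occ 0 xs <ᵇ k
... | true  = occ-raise k x xs
... | false = occ-raise k x xs

any-raise : ∀ k x xs → any (suc (suc x) <ᵇ_) (raise k xs) ≡ any (suc x <ᵇ_) xs
any-raise k x []           = refl
any-raise k x (suc y ∷ xs) rewrite any-raise k x xs = refl
any-raise k x (0     ∷ xs) with occ 0 xs <ᵇ k
... | true  = any-raise k x xs
... | false = any-raise k x xs

heads102-raise : ∀ k x xs → heads102ᵇ (suc (suc x)) (raise k xs) ≡ heads102ᵇ (suc x) xs
heads102-raise k x []           = refl
heads102-raise k x (suc y ∷ xs) rewrite heads102-raise k x xs | any-raise k x xs = refl
heads102-raise k x (0     ∷ xs) with occ 0 xs <ᵇ k
... | true  rewrite heads102-raise k x xs | any-raise k x xs = refl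
... | false rewrite heads102-raise k x xs | any-raise k x xs = refl

goodᵇ-raise : ∀ k xs → k ≤ 2 → goodᵇ (raise k xs) ≡ goodᵇ xs
goodᵇ-raise k []           _   = refl
goodᵇ-raise k (suc x ∷ xs) k≤2 rewrite goodᵇ-raise k xs k≤2 | occ-raise k x xs | heads102-raise k x xs = refl
goodᵇ-raise k (0     ∷ xs) k≤2 with occ 0 xs <ᵇ k in lt
... | false rewrite goodᵇ-raise k xs k≤2 | heads102-0 xs | heads102-0 (raise k xs) = refl
... | true  rewrite goodᵇ-raise k xs k≤2 | heads102-0 xs
                  | heads102-1 (raise k xs) (trans (occ0-raise k xs) (m≤n⇒m∸n≡0 (<⇒≤ (<ᵇ-true⁻ {occ 0 xs} {k} lt))))
                  | occ1-raise k xs | m≤n⇒m⊓n≡m (<⇒≤ (<ᵇ-true⁻ {occ 0 xs} {k} lt))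
                  | ≤ᵇ-true⁺ {occ 0 xs} {1} (s≤s⁻¹ (≤-trans (<ᵇ-true⁻ {occ 0 xs} {k} lt) k≤2)) = refl

invᵇ-raise : ∀ k j xs → invᵇ j xs ≡ true → invᵇ (suc j) (raise k xs) ≡ true
invᵇ-raise k j []           _  = refl
invᵇ-raise k j (suc x ∷ xs) ok with x≤j , ok′ ← ∧-true⁻ {suc x ≤ᵇ j} ok =
  ∧-true⁺ x≤j (invᵇ-raise k (suc j) xs ok′)
invᵇ-raise k j (0     ∷ xs) ok with occ 0 xs <ᵇ k
... | true  = invᵇ-raise k (suc j) xs ok
... | false = invᵇ-raise k (suc j) xs ok

has10-raise : ∀ k xs → has10ᵇ (raise k xs) ≡ false
has10-raise k []           = refl
has10-raise k (suc x ∷ xs) = has10-raise k xs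
has10-raise k (0     ∷ xs) with occ 0 xs <ᵇ k in lt
... | true  rewrite occ0-raise k xs | m≤n⇒m∸n≡0 (<⇒≤ (<ᵇ-true⁻ {occ 0 xs} {k} lt)) = has10-raise k xs
... | false = has10-raise k xs

endsIn0-raise-suc : ∀ k xs → endsIn0ᵇ (raise (suc k) xs) ≡ false
endsIn0-raise-suc k []           = refl
endsIn0-raise-suc k (0 ∷ [])     = refl
endsIn0-raise-suc k (suc _ ∷ []) = refl
endsIn0-raise-suc k (_ ∷ y ∷ xs) = endsIn0-raise-suc k (y ∷ xs)

endsIn0-raise-0 : ∀ xs → endsIn0ᵇ (raise 0 xs) ≡ endsIn0ᵇ xs
endsIn0-raise-0 []           = refl
endsIn0-raise-0 (0 ∷ [])     = refl
endsIn0-raise-0 (suc x ∷ []) = refl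
endsIn0-raise-0 (_ ∷ y ∷ xs) = endsIn0-raise-0 (y ∷ xs)

occ0-map-pred : ∀ ys → occ 0 (map pred ys) ≡ occ 0 ys + occ 1 ys
occ0-map-pred []                 = refl
occ0-map-pred (0 ∷ ys)           = cong suc (occ0-map-pred ys)
occ0-map-pred (1 ∷ ys)           = trans (cong suc (occ0-map-pred ys)) (sym (+-suc _ _))
occ0-map-pred (suc (suc _) ∷ ys) = occ0-map-pred ys

invᵇ-map-pred : ∀ j ys → invᵇ (suc j) ys ≡ true → invᵇ j (map pred ys) ≡ true
invᵇ-map-pred j []           _  = refl
invᵇ-map-pred j (0 ∷ ys)     ok = invᵇ-map-pred (suc j) ys ok
invᵇ-map-pred j (suc y ∷ ys) ok with y≤j , ok′ ← ∧-true⁻ {suc y ≤ᵇ suc j} ok =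
  ∧-true⁺ (≤ᵇ-true⁺ (s≤s⁻¹ (≤ᵇ-true⁻ {suc y} y≤j))) (invᵇ-map-pred (suc j) ys ok′)

raise-map-pred : ∀ k ys → has10ᵇ ys ≡ false → occ 1 ys ≤ k → occ 0 ys ≡ 0 ⊎ occ 1 ys ≡ k →
  raise k (map pred ys) ≡ ys
raise-map-pred k []                 _    _     _          = refl
raise-map-pred k (0 ∷ ys)           no10 ones≤k (inj₂ ones≡k)
  rewrite occ0-map-pred ys | <ᵇ-false⁺ {occ 0 ys + occ 1 ys} {k} (subst (_≤ occ 0 ys + occ 1 ys) ones≡k (m≤n+m _ _)) =
  cong (0 ∷_) (raise-map-pred k ys no10 ones≤k (inj₂ ones≡k))
raise-map-pred k (1 ∷ ys)           no10 ones≤k _ with has0 , no10′ ← ∨-false⁻ {1 ≤ᵇ occ 0 ys} no10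
  rewrite occ0-map-pred ys | n<1⇒n≡0 (≤ᵇ-false⁻ {1} {occ 0 ys} has0) | <ᵇ-true⁺ {occ 1 ys} {k} ones≤k =
  cong (1 ∷_) (raise-map-pred k ys no10′ (<⇒≤ ones≤k) (inj₁ (n<1⇒n≡0 (≤ᵇ-false⁻ {1} {occ 0 ys} has0))))
raise-map-pred k (suc (suc y) ∷ ys) no10 ones≤k zeros =
  cong (suc (suc y) ∷_) (raise-map-pred k ys no10 ones≤k zeros)

occ-map-suc : ∀ x xs → occ (suc x) (map suc xs) ≡ occ x xs
occ-map-suc x []       = refl
occ-map-suc x (y ∷ xs) with x ≡ᵇ y
... | true  = cong suc (occ-map-suc x xs)
... | false = occ-map-suc x xs

occ0-map-suc : ∀ xs → occ 0 (map suc xs) ≡ 0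
occ0-map-suc []       = refl
occ0-map-suc (_ ∷ xs) = occ0-map-suc xs

any-map-suc : ∀ x xs → any (suc x <ᵇ_) (map suc xs) ≡ any (x <ᵇ_) xs
any-map-suc x []       = refl
any-map-suc x (y ∷ xs) = cong ((x <ᵇ y) ∨_) (any-map-suc x xs)

heads102-map-suc : ∀ x xs → heads102ᵇ (suc x) (map suc xs) ≡ heads102ᵇ x xs
heads102-map-suc x []       = refl
heads102-map-suc x (y ∷ xs) rewrite any-map-suc x xs | heads102-map-suc x xs = refl

goodᵇ-map-suc : ∀ xs → goodᵇ (map suc xs) ≡ avoidsᵇ xs
goodᵇ-map-suc []       = refl
goodᵇ-map-suc (x ∷ xs) rewrite goodᵇ-map-suc xs | occ-map-suc x xs | heads102-map-suc x xs = refl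

invᵇ-map-suc : ∀ j xs → invᵇ (suc j) (map suc xs) ≡ invᵇ j xs
invᵇ-map-suc j []       = refl
invᵇ-map-suc j (0     ∷ xs) = invᵇ-map-suc (suc j) xs
invᵇ-map-suc j (suc x ∷ xs) = cong ((x <ᵇ j) ∧_) (invᵇ-map-suc (suc j) xs)

map-pred-map-suc : ∀ xs → map pred (map suc xs) ≡ xs
map-pred-map-suc xs = trans (sym (map-∘ xs)) (map-id xs)

map-suc-pred : ∀ xs → occ 0 xs ≡ 0 → map suc (map pred xs) ≡ xs
map-suc-pred []           _    = refl
map-suc-pred (suc x ∷ xs) no-0 = cong (suc x ∷_) (map-suc-pred xs no-0)

-- Counting good sequences by their zeros

goodᵇ[_] good⁺ᵇ[_] good¹ᵇ[_] : ℕ → List ℕ → Bool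
goodᵇ[ s ] ρ  = goodᵇ ρ ∧ (occ 0 ρ ≡ᵇ s)
good⁺ᵇ[ s ] ρ = not (endsIn0ᵇ ρ) ∧ goodᵇ[ s ] ρ
good¹ᵇ[ s ] ρ = (occ 1 ρ ≡ᵇ 1) ∧ goodᵇ[ s ] ρ

good good⁺ good¹ : ℕ → ℕ → ℕ
good  n s = count goodᵇ[ s ] (invSeqs n)
good⁺ n s = count good⁺ᵇ[ s ] (invSeqs n)
good¹ n s = count good¹ᵇ[ s ] (invSeqs n)

goodᵇ[]⁻ : ∀ s ρ → goodᵇ[ s ] ρ ≡ true → goodᵇ ρ ≡ true × occ 0 ρ ≡ s
goodᵇ[]⁻ s ρ p = Product.map₂ ≡ᵇ-true⁻ (∧-true⁻ {goodᵇ ρ} p)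

goodᵇ[]⁺ : ∀ s ρ → goodᵇ ρ ≡ true → occ 0 ρ ≡ s → goodᵇ[ s ] ρ ≡ true
goodᵇ[]⁺ s ρ ok zeros = ∧-true⁺ ok (≡ᵇ-true⁺ zeros)

good⁺ᵇ[]⁻ : ∀ s ρ → good⁺ᵇ[ s ] ρ ≡ true → endsIn0ᵇ ρ ≡ false × goodᵇ ρ ≡ true × occ 0 ρ ≡ s
good⁺ᵇ[]⁻ s ρ p with not-end , p′ ← ∧-true⁻ {not (endsIn0ᵇ ρ)} p = not-true⁻ not-end , goodᵇ[]⁻ s ρ p′

good⁺ᵇ[]⁺ : ∀ s ρ → endsIn0ᵇ ρ ≡ false → goodᵇ ρ ≡ true → occ 0 ρ ≡ s → good⁺ᵇ[ s ] ρ ≡ true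
good⁺ᵇ[]⁺ s ρ end ok zeros = ∧-true⁺ (not-true⁺ end) (goodᵇ[]⁺ s ρ ok zeros)

goodᵇ[]-false : ∀ s ρ → occ 0 ρ ≢ s → goodᵇ[ s ] ρ ≡ false
goodᵇ[]-false s ρ ≢s = trans (cong (goodᵇ ρ ∧_) (≡ᵇ-false⁺ ≢s)) (∧-zeroʳ (goodᵇ ρ))

count-∷ʳ0 : (c : List ℕ → Bool) → (∀ σ → c (σ ∷ʳ 0) ≡ c σ) → ∀ n s →
  count (λ ρ → (c ρ ∧ goodᵇ[ suc s ] ρ) ∧ endsIn0ᵇ ρ) (invSeqs (suc n)) ≡
  count (λ σ → c σ ∧ goodᵇ[ s ] σ) (invSeqs n)
count-∷ʳ0 c c-∷ʳ0 n s = count-suffix {n} (0 ∷ []) _ _ dropLast refl (λ σ → dropLast-∷ʳ σ 0)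
  (λ {ρ} p → endsIn0⇒∷ʳ0 ρ (proj₂ (∧-true⁻ p)))
  (λ σ → trans (pred-∷ʳ0 σ)) (λ σ → trans (sym (pred-∷ʳ0 σ)))
  where
  pred-∷ʳ0 : ∀ σ → (c (σ ∷ʳ 0) ∧ goodᵇ[ suc s ] (σ ∷ʳ 0)) ∧ endsIn0ᵇ (σ ∷ʳ 0) ≡ c σ ∧ goodᵇ[ s ] σ
  pred-∷ʳ0 σ rewrite c-∷ʳ0 σ | goodᵇ-∷ʳ0 σ | endsIn0-∷ʳ σ 0 | occ0-∷ʳ0 σ = ∧-identityʳ _

count-++01 : ∀ n s → count (λ ρ → good⁺ᵇ[ suc s ] ρ ∧ has10ᵇ ρ) (invSeqs (suc (suc n))) ≡ good¹ n s
count-++01 n s = count-suffix {n} [0,1] _ _ (dropLast ∘ dropLast) refl dropLast²-++01 shape to from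
  where
  ν++01 : ∀ {ρ} → (good⁺ᵇ[ suc s ] ρ ∧ has10ᵇ ρ) ≡ true → ∃[ ν ] ρ ≡ ν ++ [0,1] × occ 1 ν ≡ 1
  ν++01 {ρ} p
    with good⁺ρ , has10 ← ∧-true⁻ {good⁺ᵇ[ suc s ] ρ} p
    with end , ok , _ ← good⁺ᵇ[]⁻ (suc s) ρ good⁺ρ = ends-with-01 ρ ok has10 end
  shape : ∀ {ρ} → (good⁺ᵇ[ suc s ] ρ ∧ has10ᵇ ρ) ≡ true → ρ ≡ dropLast (dropLast ρ) ++ [0,1]
  shape {ρ} p with ν , refl , _ ← ν++01 {ρ} p = cong (_++ [0,1]) (sym (dropLast²-++01 ν))
  to : ∀ ν → good¹ᵇ[ s ] ν ≡ true → (good⁺ᵇ[ suc s ] (ν ++ [0,1]) ∧ has10ᵇ (ν ++ [0,1])) ≡ true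
  to ν p with one-1 , goodν ← ∧-true⁻ {occ 1 ν ≡ᵇ 1} p with ok , zeros ← goodᵇ[]⁻ s ν goodν =
    ∧-true⁺ (good⁺ᵇ[]⁺ (suc s) (ν ++ [0,1]) (endsIn0-++01 ν)
                       (trans (goodᵇ-++01 ν (≤-reflexive one)) ok) (trans (occ0-++01 ν) (cong suc zeros)))
            (has10-++0 ν (1 ∷ []) (≤-reflexive (sym one)))
    where one = ≡ᵇ-true⁻ one-1
  from : ∀ ν → (good⁺ᵇ[ suc s ] (ν ++ [0,1]) ∧ has10ᵇ (ν ++ [0,1])) ≡ true → good¹ᵇ[ s ] ν ≡ true
  from ν p with ν′ , eq , one ← ν++01 p with refl ← ++-cancelʳ [0,1] ν ν′ eq
    with _ , ok , zeros ← good⁺ᵇ[]⁻ (suc s) (ν ++ [0,1]) (proj₁ (∧-true⁻ {good⁺ᵇ[ suc s ] (ν ++ [0,1])} p)) =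
    ∧-true⁺ (≡ᵇ-true⁺ one) (goodᵇ[]⁺ s ν (trans (sym (goodᵇ-++01 ν (≤-reflexive one))) ok)
                                         (suc-injective (trans (sym (occ0-++01 ν)) zeros)))

lower : List ℕ → List ℕ
lower ρ = map pred (drop 1 ρ)

count-lower : ∀ k → k ≤ 2 → ∀ n s →
  count (λ ρ → (good⁺ᵇ[ suc s ] ρ ∧ not (has10ᵇ ρ)) ∧ (occ 1 ρ ≡ᵇ k)) (invSeqs (suc (suc n))) ≡
  count (λ κ → (not (k ≡ᵇ 0) ∨ not (endsIn0ᵇ κ)) ∧ goodᵇ[ k + s ] κ) (invSeqs (suc n))
count-lower k k≤2 n s = count-invSeqs-bijection (λ κ → 0 ∷ raise k κ) lower raise-emb lower-emb
  where
  P P′ : List ℕ → Bool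
  P ρ = (good⁺ᵇ[ suc s ] ρ ∧ not (has10ᵇ ρ)) ∧ (occ 1 ρ ≡ᵇ k)
  P′ κ = (not (k ≡ᵇ 0) ∨ not (endsIn0ᵇ κ)) ∧ goodᵇ[ k + s ] κ

  raise-emb : Embeds (suc n) P′ (suc (suc n)) P (λ κ → 0 ∷ raise k κ) lower
  raise-emb {κ@(x ∷ xs)} (len , inv) p′ with not-end , goodκ ← ∧-true⁻ {not (k ≡ᵇ 0) ∨ not (endsIn0ᵇ κ)} p′
    with ok , zeros ← goodᵇ[]⁻ (k + s) κ goodκ =
    (cong suc (trans (length-raise k κ) len) , invᵇ-raise k 0 κ inv) ,
    ∧-true⁺ (∧-true⁺ (good⁺ᵇ[]⁺ (suc s) (0 ∷ raise k κ) (end-raise k not-end) good-raised zeros-raised)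
                     (not-true⁺ (has10-raise k κ)))
            (≡ᵇ-true⁺ ones-raised) ,
    map-pred-raise k κ
    where
    end-raise : ∀ k → (not (k ≡ᵇ 0) ∨ not (endsIn0ᵇ κ)) ≡ true → endsIn0ᵇ (raise k κ) ≡ false
    end-raise 0       not-end = trans (endsIn0-raise-0 κ) (not-true⁻ not-end)
    end-raise (suc k) _       = endsIn0-raise-suc k κ
    good-raised : goodᵇ (0 ∷ raise k κ) ≡ true
    good-raised rewrite heads102-0 (raise k κ) | goodᵇ-raise k κ k≤2 | ok = refl
    zeros-raised : occ 0 (0 ∷ raise k κ) ≡ suc s
    zeros-raised = cong suc (trans (occ0-raise k κ) (trans (cong (_∸ k) zeros) (m+n∸m≡n k s)))
    ones-raised : occ 1 (0 ∷ raise k κ) ≡ k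
    ones-raised = trans (occ1-raise k κ) (trans (cong (_⊓ k) zeros) (m≥n⇒m⊓n≡n (m≤m+n k s)))

  lower-emb : Embeds (suc (suc n)) P (suc n) P′ lower (λ κ → 0 ∷ raise k κ)
  lower-emb {0 ∷ ys@(_ ∷ _)} (len , inv) p
    with good⁺∧no10 , ones ← ∧-true⁻ {good⁺ᵇ[ suc s ] (0 ∷ ys) ∧ not (has10ᵇ ys)} p
    with good⁺ , no10 ← ∧-true⁻ {good⁺ᵇ[ suc s ] (0 ∷ ys)} good⁺∧no10
    with end , ok , zeros ← good⁺ᵇ[]⁻ (suc s) (0 ∷ ys) good⁺ =
    (trans (length-map pred ys) (suc-injective len) , invᵇ-map-pred 0 ys inv) ,
    ∧-true⁺ (not-end-lowered k raise-lowered) (goodᵇ[]⁺ (k + s) κ good-lowered zeros-lowered) ,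
    cong (0 ∷_) raise-lowered
    where
    κ = map pred ys
    raise-lowered : raise k κ ≡ ys
    raise-lowered = raise-map-pred k ys (not-true⁻ no10) (≤-reflexive (≡ᵇ-true⁻ ones)) (inj₂ (≡ᵇ-true⁻ ones))
    not-end-lowered : ∀ k → raise k κ ≡ ys → (not (k ≡ᵇ 0) ∨ not (endsIn0ᵇ κ)) ≡ true
    not-end-lowered 0       eq = not-true⁺ (trans (sym (endsIn0-raise-0 κ)) (trans (cong endsIn0ᵇ eq) end))
    not-end-lowered (suc _) _  = refl
    good-lowered : goodᵇ κ ≡ true
    good-lowered = trans (sym (goodᵇ-raise k κ k≤2)) (trans (cong goodᵇ raise-lowered) (proj₁ (goodᵇ-∷⁻ 0 ys ok)))
    zeros-lowered : occ 0 κ ≡ k + s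
    zeros-lowered = trans (occ0-map-pred ys) (trans (cong₂ _+_ (suc-injective zeros) (≡ᵇ-true⁻ ones)) (+-comm s k))

good-one-zero : ∀ n → good (suc n) 1 ≡ count avoidsᵇ (invSeqs n)
good-one-zero n = count-invSeqs-bijection (λ σ → 0 ∷ map suc σ) lower shift-emb lower-emb
  where
  shift-emb : Embeds n avoidsᵇ (suc n) goodᵇ[ 1 ] (λ σ → 0 ∷ map suc σ) lower
  shift-emb {σ} (len , inv) ok =
    (cong suc (trans (length-map suc σ) len) , trans (invᵇ-map-suc 0 σ) inv) ,
    goodᵇ[]⁺ 1 (0 ∷ map suc σ) good-shifted (cong suc (occ0-map-suc σ)) ,
    map-pred-map-suc σ
    where
    good-shifted : goodᵇ (0 ∷ map suc σ) ≡ true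
    good-shifted rewrite heads102-0 (map suc σ) | goodᵇ-map-suc σ | ok = refl
  lower-emb : Embeds (suc n) goodᵇ[ 1 ] n avoidsᵇ lower (λ σ → 0 ∷ map suc σ)
  lower-emb {0 ∷ ys} (len , inv) p with ok , zeros ← goodᵇ[]⁻ 1 (0 ∷ ys) p =
    (trans (length-map pred ys) (suc-injective len) , invᵇ-map-pred 0 ys inv) ,
    trans (sym (goodᵇ-map-suc (map pred ys))) (trans (cong goodᵇ shift-lowered) (proj₁ (goodᵇ-∷⁻ 0 ys ok))) ,
    cong (0 ∷_) shift-lowered
    where
    shift-lowered : map suc (map pred ys) ≡ ys
    shift-lowered = map-suc-pred ys (suc-injective zeros)

good-suc : ∀ n s → good (suc n) (suc s) ≡ good n s + good⁺ (suc n) (suc s)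
good-suc n s = begin
  good (suc n) (suc s)
    ≡⟨ count-split goodᵇ[ suc s ] endsIn0ᵇ (invSeqs (suc n)) ⟩
  count (λ ρ → goodᵇ[ suc s ] ρ ∧ endsIn0ᵇ ρ) (invSeqs (suc n)) +
  count (λ ρ → goodᵇ[ suc s ] ρ ∧ not (endsIn0ᵇ ρ)) (invSeqs (suc n))
    ≡⟨ cong₂ _+_ (count-∷ʳ0 (λ _ → true) (λ _ → refl) n s)
                 (count-cong _ good⁺ᵇ[ suc s ] (invSeqs (suc n)) (λ {ρ} _ → ∧-comm (goodᵇ[ suc s ] ρ) _)) ⟩
  good n s + good⁺ (suc n) (suc s) ∎
  where open ≡-Reasoning

good⁺-suc : ∀ n s →
  good⁺ (suc (suc n)) (suc s) ≡ good¹ n s + (good⁺ (suc n) s + (good (suc n) (suc s) + good (suc n) (suc (suc s))))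
good⁺-suc n s = begin
  good⁺ (suc (suc n)) (suc s)
    ≡⟨ count-split good⁺ᵇ[ suc s ] has10ᵇ (invSeqs (suc (suc n))) ⟩
  count (λ ρ → good⁺ᵇ[ suc s ] ρ ∧ has10ᵇ ρ) (invSeqs (suc (suc n))) + count no10 (invSeqs (suc (suc n)))
    ≡⟨ cong₂ _+_ (count-++01 n s) (count-split-≤2 no10 (occ 1) (invSeqs (suc (suc n))) ones≤2) ⟩
  good¹ n s + (count (λ ρ → no10 ρ ∧ (occ 1 ρ ≡ᵇ 0)) (invSeqs (suc (suc n))) +
              (count (λ ρ → no10 ρ ∧ (occ 1 ρ ≡ᵇ 1)) (invSeqs (suc (suc n))) +
               count (λ ρ → no10 ρ ∧ (occ 1 ρ ≡ᵇ 2)) (invSeqs (suc (suc n)))))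
    ≡⟨ cong (good¹ n s +_) (cong₂ _+_ (count-lower 0 z≤n n s)
                                       (cong₂ _+_ (count-lower 1 (s≤s z≤n) n s) (count-lower 2 ≤-refl n s))) ⟩
  good¹ n s + (good⁺ (suc n) s + (good (suc n) (suc s) + good (suc n) (suc (suc s)))) ∎
  where
  open ≡-Reasoning
  no10 : List ℕ → Bool
  no10 ρ = good⁺ᵇ[ suc s ] ρ ∧ not (has10ᵇ ρ)
  ones≤2 : ∀ {ρ} → ρ ∈ invSeqs (suc (suc n)) → no10 ρ ≡ true → occ 1 ρ ≤ 2
  ones≤2 {ρ} _ p with _ , ok , _ ← good⁺ᵇ[]⁻ (suc s) ρ (proj₁ (∧-true⁻ {good⁺ᵇ[ suc s ] ρ} p)) =
    goodᵇ-occ≤2 0 ρ ok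

good¹-suc : ∀ n s → good¹ (suc n) (suc s) ≡ good¹ n s + good n (suc s)
good¹-suc n s = begin
  good¹ (suc n) (suc s)
    ≡⟨ count-split good¹ᵇ[ suc s ] endsIn0ᵇ (invSeqs (suc n)) ⟩
  count (λ ρ → good¹ᵇ[ suc s ] ρ ∧ endsIn0ᵇ ρ) (invSeqs (suc n)) +
  count (λ ρ → good¹ᵇ[ suc s ] ρ ∧ not (endsIn0ᵇ ρ)) (invSeqs (suc n))
    ≡⟨ cong₂ _+_ (count-∷ʳ0 (λ ρ → occ 1 ρ ≡ᵇ 1) (λ σ → cong (_≡ᵇ 1) (occ1-∷ʳ0 σ)) n s)
                 (not-ending-in-0 n) ⟩
  good¹ n s + good n (suc s) ∎
  where
  open ≡-Reasoning
  occ1-∷ʳ0 : ∀ σ → occ 1 (σ ∷ʳ 0) ≡ occ 1 σ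
  occ1-∷ʳ0 σ = trans (count-++ (1 ≡ᵇ_) σ (0 ∷ [])) (+-identityʳ (occ 1 σ))
  one-1-no-10 : ∀ ρ →
    (good¹ᵇ[ suc s ] ρ ∧ not (endsIn0ᵇ ρ)) ≡ ((good⁺ᵇ[ suc s ] ρ ∧ not (has10ᵇ ρ)) ∧ (occ 1 ρ ≡ᵇ 1))
  one-1-no-10 ρ with occ 1 ρ ≡ᵇ 1 in one | goodᵇ ρ in ok | endsIn0ᵇ ρ in end
  ... | false | _     | _     = sym (∧-zeroʳ _)
  ... | true  | false | true  = refl
  ... | true  | false | false = refl
  ... | true  | true  | true  = ∧-zeroʳ _
  ... | true  | true  | false rewrite one-1⇒no-10 ρ ok end (≡ᵇ-true⁻ one) = sym (∧-identityʳ _)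
  not-ending-in-0 : ∀ n → count (λ ρ → good¹ᵇ[ suc s ] ρ ∧ not (endsIn0ᵇ ρ)) (invSeqs (suc n)) ≡ good n (suc s)
  not-ending-in-0 zero    = refl
  not-ending-in-0 (suc n) =
    trans (count-cong _ _ (invSeqs (suc (suc n))) (λ {ρ} _ → one-1-no-10 ρ)) (count-lower 1 (s≤s z≤n) n s)

count-starting-with-0 : (p : List ℕ → Bool) → (∀ ys → p (0 ∷ ys) ≡ false) → ∀ n → count p (invSeqs (suc n)) ≡ 0
count-starting-with-0 p p0 n = count-none p (invSeqs (suc n)) λ ρ∈ → lemma (∈-invSeqs⁻ (suc n) ρ∈)
  where
  lemma : ∀ {ρ} → InvSeq (suc n) ρ → p ρ ≡ false
  lemma {0 ∷ ys} _ = p0 ys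

good-suc-0 : ∀ n → good (suc n) 0 ≡ 0
good-suc-0 = count-starting-with-0 goodᵇ[ 0 ] (λ ys → ∧-zeroʳ (goodᵇ (0 ∷ ys)))

good⁺-suc-0 : ∀ n → good⁺ (suc n) 0 ≡ 0
good⁺-suc-0 = count-starting-with-0 good⁺ᵇ[ 0 ] λ ys →
  trans (cong (not (endsIn0ᵇ (0 ∷ ys)) ∧_) (∧-zeroʳ (goodᵇ (0 ∷ ys)))) (∧-zeroʳ _)

good¹-suc-0 : ∀ n → good¹ (suc n) 0 ≡ 0
good¹-suc-0 = count-starting-with-0 good¹ᵇ[ 0 ] λ ys →
  trans (cong ((occ 1 ys ≡ᵇ 1) ∧_) (∧-zeroʳ (goodᵇ (0 ∷ ys)))) (∧-zeroʳ _)

good-too-many-zeros : ∀ n → good n (suc n) ≡ 0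
good-too-many-zeros n = count-none goodᵇ[ suc n ] (invSeqs n) λ {ρ} ρ∈ → goodᵇ[]-false (suc n) ρ λ zeros →
  1+n≰n (≤-trans (≤-reflexive (sym zeros)) (≤-trans (occ≤length 0 ρ) (≤-reflexive (proj₁ (∈-invSeqs⁻ n ρ∈)))))

good¹-all-zeros : ∀ n → good¹ n n ≡ 0
good¹-all-zeros n = count-none good¹ᵇ[ n ] (invSeqs n) λ {ρ} ρ∈ → case occ 0 ρ ≟ n of λ where
  (no ≢n)     → trans (cong ((occ 1 ρ ≡ᵇ 1) ∧_) (goodᵇ[]-false n ρ ≢n)) (∧-zeroʳ _)
  (yes zeros) → cong (_∧ goodᵇ[ n ] ρ) (≡ᵇ-false⁺ λ one → m+1+n≰m n
    (≤-trans (≤-reflexive (cong₂ _+_ (sym zeros) (sym one)))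
             (≤-trans (occ0+occ1≤length ρ) (≤-reflexive (proj₁ (∈-invSeqs⁻ n ρ∈))))))

good⁺-all-zeros : ∀ n → good⁺ (suc n) (suc n) ≡ 0
good⁺-all-zeros n = count-none good⁺ᵇ[ suc n ] (invSeqs (suc n)) λ {ρ} ρ∈ → case occ 0 ρ ≟ suc n of λ where
  (no ≢n)     → trans (cong (not (endsIn0ᵇ ρ) ∧_) (goodᵇ[]-false (suc n) ρ ≢n)) (∧-zeroʳ _)
  (yes zeros) → cong (λ b → not b ∧ goodᵇ[ suc n ] ρ) (all-zeros-endsIn0 ρ (proj₁ (∈-invSeqs⁻ (suc n) ρ∈)) zeros)

good-all-zeros : ∀ n → good n n ≡ 1
good-all-zeros zero    = refl
good-all-zeros (suc n) = trans (good-suc n n) (cong₂ _+_ (good-all-zeros n) (good⁺-all-zeros n))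

-- The generating tree

Σ< : ℕ → (ℕ → ℕ) → ℕ
Σ< t f = sum (map f (upTo t))

Σ<-suc : ∀ t f → Σ< (suc t) f ≡ Σ< t f + f t
Σ<-suc t f = begin
  sum (map f (upTo (suc t)))       ≡⟨ cong (sum ∘ map f) (sym (upTo-∷ʳ t)) ⟩
  sum (map f (upTo t ++ [ t ]))    ≡⟨ cong sum (map-++ f (upTo t) [ t ]) ⟩
  sum (map f (upTo t) ++ [ f t ])  ≡⟨ sum-++ (map f (upTo t)) [ f t ] ⟩
  Σ< t f + (f t + 0)               ≡⟨ cong (Σ< t f +_) (+-identityʳ (f t)) ⟩
  Σ< t f + f t                     ∎
  where open ≡-Reasoning

Σ<-cong : ∀ t {f g} → (∀ i → i < t → f i ≡ g i) → Σ< t f ≡ Σ< t g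
Σ<-cong zero    _   = refl
Σ<-cong (suc t) {f} {g} f≗g = begin
  Σ< (suc t) f  ≡⟨ Σ<-suc t f ⟩
  Σ< t f + f t  ≡⟨ cong₂ _+_ (Σ<-cong t (λ i i<t → f≗g i (m≤n⇒m≤1+n i<t))) (f≗g t ≤-refl) ⟩
  Σ< t g + g t  ≡⟨ Σ<-suc t g ⟨
  Σ< (suc t) g  ∎
  where open ≡-Reasoning

Σ<-+ : ∀ t f g → Σ< t (λ i → f i + g i) ≡ Σ< t f + Σ< t g
Σ<-+ zero    f g = refl
Σ<-+ (suc t) f g = begin
  Σ< (suc t) (λ i → f i + g i)         ≡⟨ Σ<-suc t (λ i → f i + g i) ⟩
  Σ< t (λ i → f i + g i) + (f t + g t) ≡⟨ cong (_+ (f t + g t)) (Σ<-+ t f g) ⟩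
  (Σ< t f + Σ< t g) + (f t + g t)      ≡⟨ interchange (Σ< t f) (Σ< t g) (f t) (g t) ⟩
  (Σ< t f + f t) + (Σ< t g + g t)      ≡⟨ cong₂ _+_ (Σ<-suc t f) (Σ<-suc t g) ⟨
  Σ< (suc t) f + Σ< (suc t) g          ∎
  where open ≡-Reasoning

Σ<-const-1 : ∀ t → Σ< t (λ _ → 1) ≡ t
Σ<-const-1 zero    = refl
Σ<-const-1 (suc t) = trans (Σ<-suc t (λ _ → 1)) (trans (cong (_+ 1) (Σ<-const-1 t)) (+-comm t 1))

weighted-suc : ∀ (c : ℕ → ℕ) t → Σ< (suc t) (λ i → (suc t ∸ i) * c i) ≡ Σ< t (λ i → (t ∸ i) * c i) + Σ< (suc t) c
weighted-suc c t = begin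
  Σ< (suc t) (λ i → (suc t ∸ i) * c i)
    ≡⟨ Σ<-suc t _ ⟩
  Σ< t (λ i → (suc t ∸ i) * c i) + (suc t ∸ t) * c t
    ≡⟨ cong₂ _+_ (Σ<-cong t (λ i i<t → cong (_* c i) (+-∸-assoc 1 (<⇒≤ i<t)))) (cong (_* c t) (m+n∸n≡m 1 t)) ⟩
  Σ< t (λ i → c i + (t ∸ i) * c i) + (c t + 0)
    ≡⟨ cong₂ _+_ (Σ<-+ t c _) (+-identityʳ (c t)) ⟩
  (Σ< t c + Σ< t (λ i → (t ∸ i) * c i)) + c t
    ≡⟨ xy∙z≈y∙xz (Σ< t c) _ (c t) ⟩
  Σ< t (λ i → (t ∸ i) * c i) + (Σ< t c + c t)
    ≡⟨ cong (Σ< t (λ i → (t ∸ i) * c i) +_) (Σ<-suc t c) ⟨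
  Σ< t (λ i → (t ∸ i) * c i) + Σ< (suc t) c ∎
  where open ≡-Reasoning

branch : (a b c : ℕ → ℕ) → ℕ → ℕ → ℕ
branch a b c k i = k * a i + k * b i + (k C 2) * c i

level-sum : (a b c : ℕ → ℕ) → ℕ → ℕ
level-sum a b c t = Σ< t (λ i → branch a b c (t ∸ i) i)

module _ (a b c : ℕ → ℕ) where

  branch-suc : ∀ k i → branch a b c (suc k) i ≡ branch a b c k i + ((a i + b i) + k * c i)
  branch-suc k i = trans (cong (λ q → suc k * a i + suc k * b i + q * c i) (sym suc-C2)) (polynomial k (a i) (b i) (c i) (k C 2))
    where
    suc-C2 : k + k C 2 ≡ suc k C 2
    suc-C2 = trans (cong (_+ k C 2) (sym (nC1≡n k))) (nCk+nC[k+1]≡[n+1]C[k+1] k 1)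
    polynomial : ∀ k x y z q → suc k * x + suc k * y + (k + q) * z ≡ (k * x + k * y + q * z) + ((x + y) + k * z)
    polynomial = solve-∀

  branch-1 : ∀ i → branch a b c 1 i ≡ a i + b i
  branch-1 i = polynomial (a i) (b i) (c i)
    where
    polynomial : ∀ x y z → 1 * x + 1 * y + 0 * z ≡ x + y
    polynomial = solve-∀

  level-sum-suc : ∀ t →
    level-sum a b c (suc t) ≡ level-sum a b c t + (Σ< (suc t) (λ i → a i + b i) + Σ< t (λ i → (t ∸ i) * c i))
  level-sum-suc t = begin
    Σ< (suc t) (λ i → branch a b c (suc t ∸ i) i)
      ≡⟨ Σ<-suc t _ ⟩
    Σ< t (λ i → branch a b c (suc t ∸ i) i) + branch a b c (suc t ∸ t) t
      ≡⟨ cong₂ _+_ (Σ<-cong t λ i i<t →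
                      trans (cong (λ k → branch a b c k i) (+-∸-assoc 1 (<⇒≤ i<t))) (branch-suc (t ∸ i) i))
                   (trans (cong (λ k → branch a b c k t) (m+n∸n≡m 1 t)) (branch-1 t)) ⟩
    Σ< t (λ i → branch a b c (t ∸ i) i + ((a i + b i) + (t ∸ i) * c i)) + (a t + b t)
      ≡⟨ cong (_+ (a t + b t)) (trans (Σ<-+ t _ _) (cong (level-sum a b c t +_) (Σ<-+ t _ _))) ⟩
    (level-sum a b c t + (Σ< t (λ i → a i + b i) + Σ< t (λ i → (t ∸ i) * c i))) + (a t + b t)
      ≡⟨ rearrange (level-sum a b c t) (Σ< t (λ i → a i + b i)) (Σ< t (λ i → (t ∸ i) * c i)) (a t + b t) ⟩
    level-sum a b c t + ((Σ< t (λ i → a i + b i) + (a t + b t)) + Σ< t (λ i → (t ∸ i) * c i))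
      ≡⟨ cong (λ x → level-sum a b c t + (x + Σ< t (λ i → (t ∸ i) * c i))) (Σ<-suc t (λ i → a i + b i)) ⟨
    level-sum a b c t + (Σ< (suc t) (λ i → a i + b i) + Σ< t (λ i → (t ∸ i) * c i)) ∎
    where
    open ≡-Reasoning
    rearrange : ∀ l u v x → (l + (u + v)) + x ≡ l + ((u + x) + v)
    rearrange = solve-∀

  level-sum-second-difference : ∀ t →
    level-sum a b c (suc (suc t)) + level-sum a b c t ≡
    (level-sum a b c (suc t) + level-sum a b c (suc t)) + ((a (suc t) + b (suc t)) + Σ< (suc t) c)
  level-sum-second-difference t = begin
    F (suc (suc t)) + F t
      ≡⟨ cong (_+ F t) (level-sum-suc (suc t)) ⟩
    (F (suc t) + (U (suc (suc t)) + V (suc t))) + F t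
      ≡⟨ cong (λ x → (F (suc t) + x) + F t) (cong₂ _+_ (Σ<-suc (suc t) (λ i → a i + b i)) (weighted-suc c t)) ⟩
    (F (suc t) + ((U (suc t) + (a (suc t) + b (suc t))) + (V t + Σ< (suc t) c))) + F t
      ≡⟨ cong (λ x → (x + ((U (suc t) + (a (suc t) + b (suc t))) + (V t + Σ< (suc t) c))) + F t) (level-sum-suc t) ⟩
    ((F t + (U (suc t) + V t)) + ((U (suc t) + (a (suc t) + b (suc t))) + (V t + Σ< (suc t) c))) + F t
      ≡⟨ rearrange (F t) (U (suc t)) (V t) (a (suc t) + b (suc t)) (Σ< (suc t) c) ⟩
    ((F t + (U (suc t) + V t)) + (F t + (U (suc t) + V t))) + ((a (suc t) + b (suc t)) + Σ< (suc t) c)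
      ≡⟨ cong (λ x → (x + x) + ((a (suc t) + b (suc t)) + Σ< (suc t) c)) (level-sum-suc t) ⟨
    (F (suc t) + F (suc t)) + ((a (suc t) + b (suc t)) + Σ< (suc t) c) ∎
    where
    open ≡-Reasoning
    F U V : ℕ → ℕ
    F = level-sum a b c
    U t = Σ< t (λ i → a i + b i)
    V t = Σ< t (λ i → (t ∸ i) * c i)
    rearrange : ∀ l u v x y → ((l + (u + v)) + ((u + x) + (v + y))) + l ≡ ((l + (u + v)) + (l + (u + v))) + (x + y)
    rearrange = solve-∀

nodes-suc-0 : ∀ d → nodes (suc d) 0 ≡ 0
nodes-suc-0 zero    = refl
nodes-suc-0 (suc d) = refl

nodes-1-suc : ∀ s → nodes 1 (suc s) ≡ nodes 1 s + suc s
nodes-1-suc s = trans (weighted-suc (λ _ → 1) s) (cong (nodes 1 s +_) (Σ<-const-1 (suc s)))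

nodes-suc-suc-1 : ∀ d → nodes (suc (suc d)) 1 ≡ nodes (suc d) 1 + nodes d 2
nodes-suc-suc-1 d =
  trans (+-identityʳ _) (branch-1 (λ i → nodes (suc d) (suc i)) (λ i → nodes d (suc (suc i))) (λ i → nodes d (suc i)) 0)

nodes-second-difference : ∀ d s →
  nodes (suc (suc d)) (suc (suc s)) + nodes (suc (suc d)) s ≡
  (nodes (suc (suc d)) (suc s) + nodes (suc (suc d)) (suc s)) +
  ((nodes (suc d) (suc (suc s)) + nodes d (suc (suc (suc s)))) + Σ< (suc s) (λ i → nodes d (suc i)))
nodes-second-difference d =
  level-sum-second-difference (λ i → nodes (suc d) (suc i)) (λ i → nodes d (suc (suc i))) (λ i → nodes d (suc i))

first-differences : (M P X : ℕ → ℕ) → M 1 ≡ M 0 + P 1 →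
  (∀ s → P (suc (suc s)) ≡ P (suc s) + X s) →
  (∀ s → M (suc (suc s)) + M s ≡ (M (suc s) + M (suc s)) + X s) →
  ∀ s → M (suc s) ≡ M s + P (suc s)
first-differences M P X base P-suc M-second zero    = base
first-differences M P X base P-suc M-second (suc s) = +-cancelʳ-≡ (M s) _ _ (begin
  M (suc (suc s)) + M s                          ≡⟨ M-second s ⟩
  (M (suc s) + M (suc s)) + X s                  ≡⟨ cong (λ m → (M (suc s) + m) + X s) ih ⟩
  (M (suc s) + (M s + P (suc s))) + X s          ≡⟨ rearrange (M (suc s)) (M s) (P (suc s)) (X s) ⟩
  (M (suc s) + (P (suc s) + X s)) + M s          ≡⟨ cong (λ p → (M (suc s) + p) + M s) (P-suc s) ⟨
  (M (suc s) + P (suc (suc s))) + M s            ∎)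
  where
  open ≡-Reasoning
  ih = first-differences M P X base P-suc M-second s
  rearrange : ∀ m m′ p x → (m + (m′ + p)) + x ≡ (m + (p + x)) + m′
  rearrange = solve-∀

-- Good sequences by number of positive entries

G G⁺ G¹ : ℕ → ℕ → ℕ
G  d s = good  (d + s) s
G⁺ d s = good⁺ (d + s) s
G¹ d s = good¹ (d + s) s

G-suc : ∀ d s → G d (suc s) ≡ G d s + G⁺ d (suc s)
G-suc d s rewrite +-suc d s = good-suc (d + s) s

G⁺-suc : ∀ d s → G⁺ (suc (suc d)) (suc s) ≡ G¹ (suc d) s + (G⁺ (suc (suc d)) s + (G (suc d) (suc s) + G d (suc (suc s))))
G⁺-suc d s rewrite +-suc d (suc s) | +-suc d s = good⁺-suc (suc (d + s)) s

G¹-suc : ∀ d s → G¹ (suc d) (suc s) ≡ G¹ (suc d) s + G d (suc s)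
G¹-suc d s rewrite +-suc d s = good¹-suc (suc (d + s)) s

G⁺-1 : ∀ s → G⁺ 1 s ≡ s
G⁺-1 zero    = good⁺-suc-0 0
G⁺-1 (suc s) = begin
  good⁺ (suc (suc s)) (suc s)
    ≡⟨ good⁺-suc s s ⟩
  good¹ s s + (good⁺ (suc s) s + (good (suc s) (suc s) + good (suc s) (suc (suc s))))
    ≡⟨ cong₂ _+_ (good¹-all-zeros s)
                 (cong₂ _+_ (G⁺-1 s) (cong₂ _+_ (good-all-zeros (suc s)) (good-too-many-zeros (suc s)))) ⟩
  s + 1
    ≡⟨ +-comm s 1 ⟩
  suc s ∎
  where open ≡-Reasoning

Agree : ℕ → Set
Agree d = ∀ s → G d s ≡ nodes d s

agree-0 : Agree 0
agree-0 = good-all-zeros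

agree-suc : ∀ d → (∀ s → nodes (suc d) (suc s) ≡ nodes (suc d) s + G⁺ (suc d) (suc s)) → Agree (suc d)
agree-suc d nodes-suc zero    = trans (good-suc-0 (d + 0)) (sym (nodes-suc-0 d))
agree-suc d nodes-suc (suc s) = begin
  G (suc d) (suc s)                        ≡⟨ G-suc (suc d) s ⟩
  G (suc d) s + G⁺ (suc d) (suc s)         ≡⟨ cong (_+ G⁺ (suc d) (suc s)) (agree-suc d nodes-suc s) ⟩
  nodes (suc d) s + G⁺ (suc d) (suc s)     ≡⟨ nodes-suc s ⟨
  nodes (suc d) (suc s)                    ∎
  where open ≡-Reasoning

agree-1 : Agree 1
agree-1 = agree-suc 0 λ s → trans (nodes-1-suc s) (cong (nodes 1 s +_) (sym (G⁺-1 (suc s))))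

G¹-sum : ∀ d → Agree d → ∀ s → G¹ (suc d) s ≡ Σ< s (λ i → nodes d (suc i))
G¹-sum d agree-d zero    = good¹-suc-0 (d + 0)
G¹-sum d agree-d (suc s) = begin
  G¹ (suc d) (suc s)                        ≡⟨ G¹-suc d s ⟩
  G¹ (suc d) s + G d (suc s)                ≡⟨ cong₂ _+_ (G¹-sum d agree-d s) (agree-d (suc s)) ⟩
  Σ< s (λ i → nodes d (suc i)) + nodes d (suc s) ≡⟨ Σ<-suc s (λ i → nodes d (suc i)) ⟨
  Σ< (suc s) (λ i → nodes d (suc i))        ∎
  where open ≡-Reasoning

agree-suc-suc : ∀ d → Agree d → Agree (suc d) → Agree (suc (suc d))
agree-suc-suc d agree-d agree-d+1 =
  agree-suc (suc d) (first-differences (nodes (suc (suc d))) (G⁺ (suc (suc d))) X base G⁺-second (nodes-second-difference d))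
  where
  X : ℕ → ℕ
  X s = (nodes (suc d) (suc (suc s)) + nodes d (suc (suc (suc s)))) + Σ< (suc s) (λ i → nodes d (suc i))
  G⁺-second : ∀ s → G⁺ (suc (suc d)) (suc (suc s)) ≡ G⁺ (suc (suc d)) (suc s) + X s
  G⁺-second s = begin
    G⁺ (suc (suc d)) (suc (suc s))
      ≡⟨ G⁺-suc d (suc s) ⟩
    G¹ (suc d) (suc s) + (G⁺ (suc (suc d)) (suc s) + (G (suc d) (suc (suc s)) + G d (suc (suc (suc s)))))
      ≡⟨ cong₂ _+_ (G¹-sum d agree-d (suc s))
                   (cong (G⁺ (suc (suc d)) (suc s) +_) (cong₂ _+_ (agree-d+1 (suc (suc s))) (agree-d (suc (suc (suc s)))))) ⟩
    Σ< (suc s) (λ i → nodes d (suc i)) + (G⁺ (suc (suc d)) (suc s) + (nodes (suc d) (suc (suc s)) + nodes d (suc (suc (suc s)))))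
      ≡⟨ x∙yz≈y∙zx (Σ< (suc s) (λ i → nodes d (suc i))) (G⁺ (suc (suc d)) (suc s)) _ ⟩
    G⁺ (suc (suc d)) (suc s) + X s ∎
    where open ≡-Reasoning
  base : nodes (suc (suc d)) 1 ≡ 0 + G⁺ (suc (suc d)) 1
  base = sym (begin
    G⁺ (suc (suc d)) 1
      ≡⟨ G⁺-suc d 0 ⟩
    G¹ (suc d) 0 + (G⁺ (suc (suc d)) 0 + (G (suc d) 1 + G d 2))
      ≡⟨ cong₂ _+_ (good¹-suc-0 (d + 0)) (cong₂ _+_ (good⁺-suc-0 (suc (d + 0))) (cong₂ _+_ (agree-d+1 1) (agree-d 2))) ⟩
    nodes (suc d) 1 + nodes d 2
      ≡⟨ nodes-suc-suc-1 d ⟨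
    nodes (suc (suc d)) 1 ∎)
    where open ≡-Reasoning

agree : ∀ d → Agree d × Agree (suc d)
agree zero    = agree-0 , agree-1
agree (suc d) = proj₂ (agree d) , agree-suc-suc d (proj₁ (agree d)) (proj₂ (agree d))

theorem3 : (n : ℕ) → levelCount n ≡ numAvoiding ((0 ∷ 0 ∷ 0 ∷ []) ∷ (1 ∷ 0 ∷ 2 ∷ []) ∷ []) n
theorem3 n = begin
  nodes n 1                       ≡⟨ proj₁ (agree n) 1 ⟨
  good (n + 1) 1                  ≡⟨ cong (λ m → good m 1) (+-comm n 1) ⟩
  good (suc n) 1                  ≡⟨ good-one-zero n ⟩
  count avoidsᵇ (invSeqs n)       ≡⟨ numAvoiding-000-102 n ⟨
  numAvoiding ((0 ∷ 0 ∷ 0 ∷ []) ∷ (1 ∷ 0 ∷ 2 ∷ []) ∷ []) n ∎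
  where open ≡-Reasoning
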